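{- Let $n\ge 2$. There is a bijection $\Phi$ from the set of $n\times n$ permutation matrices to the set of TSSCPP boolean triangles of order $n$ with weakly decreasing rows such that for every permutation matrix $P$, writing $b=\Phi(P)$: (i) the number of entries of $b$ equal to $0$ equals the inversion number of $P$; (ii) if the $1$ in the last row of $P$ lies in column $k$, then exactly $n-k$ of the zeros of $b$ lie in its last row (row $n-1$); (iii) if the $1$ in the last column of $P$ lies in row $\ell$, then the lowest $1$ in diagonal $n-1$ of $b$ (i.e. among the entries $b_{1,n-1},b_{2,n-1},\dots,b_{n-1,n-1}$) is in row $\ell-1$, that is, $b_{i,n-1}=0$ for all $\ell\le i\le n-1$ and, if $\ell\geq 2$, $b_{\ell-1,n-1}=1$.
   Context: A TSSCPP boolean triangle of order $n$ is an array $\{b_{i,j}\}$ indexed by $1\leq i\leq n-1$, $n-i\leq j\leq n-1$ (row $i$ has the $i$ entries $b_{i,n-i},\dots,b_{i,n-1}$), with entries in $\{0,1\}$, such that for all $j$ and all $i'$ with $j\le i'\le n-1$ the diagonal partial sums satisfy $$1+\sum_{i=j+1}^{i'} b_{i,n-j-1} \;\geq\; \sum_{i=j}^{i'} b_{i,n-j},$$ where sums over empty index ranges are $0$. Its rows are weakly decreasing if $b_{i,j}\ge b_{i,j+1}$ whenever both entries exist. An $n\times n$ permutation matrix $P$ corresponds to the permutation $\sigma$ with $P_{i,\sigma(i)}=1$; its inversion number is the number of pairs $i<j$ with $\sigma(j)<\sigma(i)$. In (iii), the case $\ell=1$ means that diagonal $n-1$ contains no $1$. -}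

module Defs where

open import Data.Nat using (ℕ; zero; suc; _+_; _∸_; _≤_; _<_; _≡ᵇ_; _≤ᵇ_; _<ᵇ_)
open import Data.Bool using (Bool; true; false; _∧_; _∨_; not; if_then_else_; T)
open import Data.Vec using (Vec; []; _∷_)
open import Data.List using (List; map; upTo; foldr)
open import Data.Nat.ListAction using (sum)
open import Data.Product using (Σ; _×_; _,_)
open import Data.Unit using (⊤)

vAt : {A : Set} → A → {m : ℕ} → Vec A m → ℕ → A
vAt d []       _       = d
vAt d (x ∷ xs) zero    = x
vAt d (x ∷ xs) (suc p) = vAt d xs p

-- the list [a, a+1, ..., b]  (empty if b < a)
range : ℕ → ℕ → List ℕ
range a b = map (a +_) (upTo (suc b ∸ a))

sumR : ℕ → ℕ → (ℕ → ℕ) → ℕ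
sumR a b f = sum (map f (range a b))

allR : ℕ → ℕ → (ℕ → Bool) → Bool
allR a b f = foldr (λ i r → f i ∧ r) true (range a b)

bit : Bool → ℕ
bit true  = 1
bit false = 0

-- n × n 0/1 matrices, 1-indexed access  M(i,j)  (false out of range)

Mat : ℕ → Set
Mat n = Vec (Vec Bool n) n

mat : {n : ℕ} → Mat n → ℕ → ℕ → Bool
mat {n} M i j = vAt false (vAt (Data.Vec.replicate n false) M (i ∸ 1)) (j ∸ 1)
  where import Data.Vec

isPermMat : {n : ℕ} → Mat n → Bool
isPermMat {n} M =
  allR 1 n (λ i → sumR 1 n (λ j → bit (mat M i j)) ≡ᵇ 1) ∧
  allR 1 n (λ j → sumR 1 n (λ i → bit (mat M i j)) ≡ᵇ 1)

PermMat : ℕ → Set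
PermMat n = Σ (Mat n) (λ M → T (isPermMat M))

-- σ(i) : the column of the 1 in row i  (P_{i,σ(i)} = 1);
-- computed as the first such column (unique for a permutation matrix)
firstR : ℕ → ℕ → (ℕ → Bool) → ℕ
firstR a b f = foldr (λ j r → if f j then j else r) 0 (range a b)

sigma : {n : ℕ} → Mat n → ℕ → ℕ
sigma {n} M i = firstR 1 n (λ j → mat M i j)

inv : {n : ℕ} → Mat n → ℕ
inv {n} M = sumR 1 n (λ i → sumR (suc i) n (λ j → bit (sigma M j <ᵇ sigma M i)))

-- Triangles of order n: rows 1..n-1, row i being a vector of i booleans
-- (b_{i,n-i}, ..., b_{i,n-1}).

Rows : ℕ → Set
Rows zero    = ⊤
Rows (suc k) = Rows k × Vec Bool (suc k)

-- entry at row i (1-indexed), position p (0-indexed) inside the row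
rowsAt : (k : ℕ) → Rows k → ℕ → ℕ → Bool
rowsAt zero    _        i p = false
rowsAt (suc k) (rs , r) i p =
  if i ≡ᵇ suc k then vAt false r p else rowsAt k rs i p

Tri : ℕ → Set
Tri n = Rows (n ∸ 1)

-- b_{i,j} for 1 ≤ i ≤ n-1, n-i ≤ j ≤ n-1 ; false (= 0) outside this range
tri : (n : ℕ) → Tri n → ℕ → ℕ → Bool
tri n b i j =
  if (n ≤ᵇ i + j) ∧ (j <ᵇ n) then rowsAt (n ∸ 1) b i (i + j ∸ n) else false

isTSSCPP : (n : ℕ) → Tri n → Bool
isTSSCPP n b =
  allR 0 (n ∸ 1) (λ j → allR j (n ∸ 1) (λ i' →
    sumR j i' (λ i → bit (tri n b i (n ∸ j)))
      ≤ᵇ 1 + sumR (suc j) i' (λ i → bit (tri n b i (n ∸ j ∸ 1)))))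

decRows : (n : ℕ) → Tri n → Bool
decRows n b =
  allR 1 (n ∸ 1) (λ i → allR (n ∸ i) (n ∸ 2) (λ j →
    tri n b i j ∨ not (tri n b i (suc j))))

BoolTri : ℕ → Set
BoolTri n = Σ (Tri n) (λ b → T (isTSSCPP n b ∧ decRows n b))

zeros : (n : ℕ) → Tri n → ℕ
zeros n b = sumR 1 (n ∸ 1) (λ i → sumR (n ∸ i) (n ∸ 1) (λ j → bit (not (tri n b i j))))

zerosLastRow : (n : ℕ) → Tri n → ℕ
zerosLastRow n b = sumR 1 (n ∸ 1) (λ j → bit (not (tri n b (n ∸ 1) j)))

module Submission where

-- Both sides are parametrised by codes: functions c with c i ≤ i for i < n (a Lehmer code).
--   * perm n c  is built by induction on n: row n goes to column c (n-1) + 1 and the columns of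
--     rows 1..n-1, given by perm (n-1) c, are shifted past it.  Conversely  matCode  reads the
--     code off a permutation matrix by recording the column of its last row and deleting that
--     row and column.  These are mutually inverse, and perm n c has  Σ_i (i - c i)  inversions,
--     since the new last row creates  (n-1) - c (n-1)  of them.
--   * codeTri c  is the triangle whose row i is  c i  ones followed by  i - c i  zeros.  Its rows
--     decrease, the TSSCPP condition follows from decreasing rows alone, and a triangle with
--     decreasing rows is the codeTri of its row sums.
-- Φ sends P to the triangle of its code.  Then (i) is the inversion count, (ii) says that row
-- n-1 has  (n-1) - c (n-1) = n - σ(n)  zeros, and (iii) follows from  b_{i,n-1} = [c i = i]
-- and the description of the row σ⁻¹(n) by the code (perm⁻¹-last).

open import Defs
open import Data.Nat using (ℕ; zero; suc; _+_; _∸_; _≤_; _<_; _≡ᵇ_; _≤ᵇ_; _<ᵇ_; z≤n; s≤s; z<s)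
open import Data.Nat.Properties
open import Data.Bool using (Bool; true; false; _∧_; _∨_; not; if_then_else_; T)
open import Data.Bool.Properties using (T-≡; T-irrelevant; ¬-not; not-¬)
open import Data.Vec using (Vec; []; _∷_)
open import Data.List using (foldr; applyUpTo)
open import Data.List.Properties using (foldr-map; map-upTo)
open import Data.Product using (Σ; _×_; _,_; proj₁; proj₂)
open import Data.Product.Properties using (Σ-≡,≡→≡)
open import Data.Sum using (inj₁; inj₂)
open import Data.Unit using (tt)
open import Data.Empty using (⊥; ⊥-elim)
open import Function using (_∘_)
open import Function.Bundles using (Equivalence; Bijection; mk↔ₛ′)
open import Function.Definitions using (Bijective)
open import Function.Properties.Inverse using (↔⇒⤖)
open import Relation.Nullary using (¬_; yes; no)
open import Relation.Binary.PropositionalEquality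
open import Algebra.Properties.CommutativeSemigroup +-commutativeSemigroup using (interchange)

T⇒≡true : ∀ {b} → T b → b ≡ true
T⇒≡true = Equivalence.to T-≡

≡true⇒T : ∀ {b} → b ≡ true → T b
≡true⇒T = Equivalence.from T-≡

≡ᵇ-true : ∀ {m n} → m ≡ n → (m ≡ᵇ n) ≡ true
≡ᵇ-true {m} {n} m≡n = T⇒≡true (≡⇒≡ᵇ m n m≡n)

≡ᵇ-sound : ∀ m n → (m ≡ᵇ n) ≡ true → m ≡ n
≡ᵇ-sound m n e = ≡ᵇ⇒≡ m n (≡true⇒T e)

≡ᵇ-false : ∀ {m n} → m ≢ n → (m ≡ᵇ n) ≡ false
≡ᵇ-false {m} {n} m≢n = ¬-not (m≢n ∘ ≡ᵇ-sound m n)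

<ᵇ-true : ∀ {m n} → m < n → (m <ᵇ n) ≡ true
<ᵇ-true m<n = T⇒≡true (<⇒<ᵇ m<n)

<ᵇ-sound : ∀ m n → (m <ᵇ n) ≡ true → m < n
<ᵇ-sound m n e = <ᵇ⇒< m n (≡true⇒T e)

<ᵇ-false : ∀ {m n} → n ≤ m → (m <ᵇ n) ≡ false
<ᵇ-false {m} {n} n≤m = ¬-not (≤⇒≯ n≤m ∘ <ᵇ-sound m n)

≤ᵇ-true : ∀ {m n} → m ≤ n → (m ≤ᵇ n) ≡ true
≤ᵇ-true m≤n = T⇒≡true (≤⇒≤ᵇ m≤n)

≤ᵇ-false : ∀ {m n} → n < m → (m ≤ᵇ n) ≡ false
≤ᵇ-false {m} {n} n<m = ¬-not (<⇒≱ n<m ∘ ≤ᵇ⇒≤ m n ∘ ≡true⇒T)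

<ᵇ-suc : ∀ k x → (k <ᵇ suc x) ≡ (k ≤ᵇ x)
<ᵇ-suc zero    x = refl
<ᵇ-suc (suc k) x = refl

∧-left : ∀ {x y} → (x ∧ y) ≡ true → x ≡ true
∧-left {true} _ = refl

∧-right : ∀ {x y} → (x ∧ y) ≡ true → y ≡ true
∧-right {true} e = e

∧-intro : ∀ {x y} → x ≡ true → y ≡ true → (x ∧ y) ≡ true
∧-intro refl refl = refl

if-true : ∀ {X : Set} {b} {x y : X} → b ≡ true → (if b then x else y) ≡ x
if-true refl = refl

if-false : ∀ {X : Set} {b} {x y : X} → b ≡ false → (if b then x else y) ≡ y
if-false refl = refl

foldFrom : {X : Set} → (ℕ → X → X) → X → ℕ → ℕ → X
foldFrom g e a zero    = e
foldFrom g e a (suc l) = g a (foldFrom g e (suc a) l)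

foldr-range : ∀ {X : Set} (g : ℕ → X → X) e a b →
  foldr g e (range a b) ≡ foldFrom g e a (suc b ∸ a)
foldr-range g e a b =
  trans (cong (foldr g e) (map-upTo (a +_) (suc b ∸ a))) (foldr-applyUpTo (suc b ∸ a) a (a +_) (λ _ → refl))
  where
  foldr-applyUpTo : ∀ l a′ h → (∀ q → h q ≡ a′ + q) → foldr g e (applyUpTo h l) ≡ foldFrom g e a′ l
  foldr-applyUpTo zero    a′ h h≗ = refl
  foldr-applyUpTo (suc l) a′ h h≗ =
    cong₂ g (trans (h≗ 0) (+-identityʳ a′))
            (foldr-applyUpTo l (suc a′) (h ∘ suc) (λ q → trans (h≗ (suc q)) (+-suc a′ q)))

sumFrom : ℕ → ℕ → (ℕ → ℕ) → ℕ
sumFrom a l f = foldFrom (λ i r → f i + r) 0 a l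

allFrom : ℕ → ℕ → (ℕ → Bool) → Bool
allFrom a l f = foldFrom (λ i r → f i ∧ r) true a l

firstFrom : ℕ → ℕ → (ℕ → Bool) → ℕ
firstFrom a l f = foldFrom (λ j r → if f j then j else r) 0 a l

sumR-sumFrom : ∀ a b f → sumR a b f ≡ sumFrom a (suc b ∸ a) f
sumR-sumFrom a b f = trans (foldr-map _+_ f 0 (range a b)) (foldr-range _ 0 a b)

allR-allFrom : ∀ a b f → allR a b f ≡ allFrom a (suc b ∸ a) f
allR-allFrom a b f = foldr-range _ true a b

firstR-firstFrom : ∀ a b f → firstR a b f ≡ firstFrom a (suc b ∸ a) f
firstR-firstFrom a b f = foldr-range _ 0 a b

head-in : ∀ a l → a < a + suc l
head-in a l = m<m+n a z<s

tail⇒window : ∀ {i} a l → i < suc a + l → i < a + suc l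
tail⇒window {i} a l = subst (i <_) (sym (+-suc a l))

window⇒tail : ∀ {i} a l → i < a + suc l → i < suc a + l
window⇒tail {i} a l = subst (i <_) (+-suc a l)

empty-window : ∀ {a i} → a ≤ i → ¬ (i < a + 0)
empty-window {a} a≤i i<a = ≤⇒≯ a≤i (subst (_ <_) (+-identityʳ a) i<a)

sumFrom-cong : ∀ l a (f g : ℕ → ℕ) → (∀ i → a ≤ i → i < a + l → f i ≡ g i) → sumFrom a l f ≡ sumFrom a l g
sumFrom-cong zero    a f g f≗g = refl
sumFrom-cong (suc l) a f g f≗g =
  cong₂ _+_ (f≗g a ≤-refl (head-in a l))
            (sumFrom-cong l (suc a) f g (λ i a<i i<l → f≗g i (<⇒≤ a<i) (tail⇒window a l i<l)))

sumFrom-snoc : ∀ l a f → sumFrom a (suc l) f ≡ sumFrom a l f + f (a + l)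
sumFrom-snoc zero    a f = trans (+-identityʳ (f a)) (cong f (sym (+-identityʳ a)))
sumFrom-snoc (suc l) a f = begin
  f a + sumFrom (suc a) (suc l) f          ≡⟨ cong (f a +_) (sumFrom-snoc l (suc a) f) ⟩
  f a + (sumFrom (suc a) l f + f (suc a + l)) ≡⟨ sym (+-assoc (f a) _ _) ⟩
  f a + sumFrom (suc a) l f + f (suc a + l)   ≡⟨ cong (λ x → f a + sumFrom (suc a) l f + f x) (sym (+-suc a l)) ⟩
  f a + sumFrom (suc a) l f + f (a + suc l)   ∎
  where open ≡-Reasoning

sumFrom-+ : ∀ l a f g → sumFrom a l (λ i → f i + g i) ≡ sumFrom a l f + sumFrom a l g
sumFrom-+ zero    a f g = refl
sumFrom-+ (suc l) a f g =
  trans (cong (f a + g a +_) (sumFrom-+ l (suc a) f g)) (interchange (f a) (g a) _ _)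

sumFrom-mono : ∀ l a (f g : ℕ → ℕ) → (∀ i → a ≤ i → i < a + l → f i ≤ g i) → sumFrom a l f ≤ sumFrom a l g
sumFrom-mono zero    a f g f≤g = z≤n
sumFrom-mono (suc l) a f g f≤g =
  +-mono-≤ (f≤g a ≤-refl (head-in a l))
           (sumFrom-mono l (suc a) f g (λ i a<i i<l → f≤g i (<⇒≤ a<i) (tail⇒window a l i<l)))

sumFrom-shift : ∀ l k a f → sumFrom (k + a) l f ≡ sumFrom a l (λ i → f (k + i))
sumFrom-shift zero    k a f = refl
sumFrom-shift (suc l) k a f =
  cong (f (k + a) +_) (trans (cong (λ x → sumFrom x l f) (sym (+-suc k a))) (sumFrom-shift l k (suc a) f))

sumFrom-bits-0 : ∀ l a (g : ℕ → Bool) → (∀ i → a ≤ i → i < a + l → g i ≡ false) →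
  sumFrom a l (bit ∘ g) ≡ 0
sumFrom-bits-0 zero    a g none = refl
sumFrom-bits-0 (suc l) a g none rewrite none a ≤-refl (head-in a l) =
  sumFrom-bits-0 l (suc a) g (λ i a<i i<l → none i (<⇒≤ a<i) (tail⇒window a l i<l))

sumFrom-bits-0⁻¹ : ∀ l a (g : ℕ → Bool) → sumFrom a l (bit ∘ g) ≡ 0 →
  ∀ i → a ≤ i → i < a + l → g i ≡ false
sumFrom-bits-0⁻¹ zero    a g s≡0 i a≤i i<l = ⊥-elim (empty-window a≤i i<l)
sumFrom-bits-0⁻¹ (suc l) a g s≡0 i a≤i i<l with g a in ga | m≤n⇒m<n∨m≡n a≤i
... | true  | _        = ⊥-elim (1+n≢0 s≡0)
... | false | inj₂ refl = ga
... | false | inj₁ a<i  = sumFrom-bits-0⁻¹ l (suc a) g s≡0 i a<i (window⇒tail a l i<l)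

ExactlyOne : ℕ → ℕ → (ℕ → Bool) → Set
ExactlyOne a l g = Σ ℕ λ p → (a ≤ p) × (p < a + l) × (g p ≡ true) ×
                     (∀ j → a ≤ j → j < a + l → g j ≡ true → j ≡ p)

sumFrom-bits-1⁻¹ : ∀ l a (g : ℕ → Bool) → sumFrom a l (bit ∘ g) ≡ 1 → ExactlyOne a l g
sumFrom-bits-1⁻¹ zero    a g ()
sumFrom-bits-1⁻¹ (suc l) a g s≡1 with g a in ga
... | true  = a , ≤-refl , head-in a l , ga , only-a
  where
  only-a : ∀ j → a ≤ j → j < a + suc l → g j ≡ true → j ≡ a
  only-a j a≤j j<l gj with m≤n⇒m<n∨m≡n a≤j
  ... | inj₂ a≡j = sym a≡j
  ... | inj₁ a<j with () ← trans (sym gj) (sumFrom-bits-0⁻¹ l (suc a) g (suc-injective s≡1) j a<j (window⇒tail a l j<l))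
... | false with sumFrom-bits-1⁻¹ l (suc a) g s≡1
...   | p , a<p , p<l , gp , only-p = p , <⇒≤ a<p , tail⇒window a l p<l , gp , only-p′
  where
  only-p′ : ∀ j → a ≤ j → j < a + suc l → g j ≡ true → j ≡ p
  only-p′ j a≤j j<l gj with m≤n⇒m<n∨m≡n a≤j
  ... | inj₁ a<j  = only-p j a<j (window⇒tail a l j<l) gj
  ... | inj₂ refl with () ← trans (sym gj) ga

sumFrom-bits-1 : ∀ l a (g : ℕ → Bool) → ExactlyOne a l g → sumFrom a l (bit ∘ g) ≡ 1
sumFrom-bits-1 zero    a g (p , a≤p , p<l , _) = ⊥-elim (empty-window a≤p p<l)
sumFrom-bits-1 (suc l) a g (p , a≤p , p<l , gp , only-p) with g a in ga
... | true  = cong suc (sumFrom-bits-0 l (suc a) g others-false)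
  where
  others-false : ∀ i → suc a ≤ i → i < suc a + l → g i ≡ false
  others-false i a<i i<l = ¬-not λ gi →
    <-irrefl (trans (only-p a ≤-refl (head-in a l) ga) (sym (only-p i (<⇒≤ a<i) (tail⇒window a l i<l) gi))) a<i
... | false = sumFrom-bits-1 l (suc a) g (p , a<p , window⇒tail a l p<l , gp ,
                λ j a<j j<l → only-p j (<⇒≤ a<j) (tail⇒window a l j<l))
  where
  a<p : a < p
  a<p with m≤n⇒m<n∨m≡n a≤p
  ... | inj₁ a<p  = a<p
  ... | inj₂ refl with () ← trans (sym gp) ga

allFrom-true⁻¹ : ∀ l a (f : ℕ → Bool) → allFrom a l f ≡ true → ∀ i → a ≤ i → i < a + l → f i ≡ true
allFrom-true⁻¹ zero    a f all i a≤i i<l = ⊥-elim (empty-window a≤i i<l)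
allFrom-true⁻¹ (suc l) a f all i a≤i i<l with m≤n⇒m<n∨m≡n a≤i
... | inj₂ refl = ∧-left all
... | inj₁ a<i  = allFrom-true⁻¹ l (suc a) f (∧-right {f a} all) i a<i (window⇒tail a l i<l)

allFrom-true : ∀ l a (f : ℕ → Bool) → (∀ i → a ≤ i → i < a + l → f i ≡ true) → allFrom a l f ≡ true
allFrom-true zero    a f every = refl
allFrom-true (suc l) a f every =
  ∧-intro (every a ≤-refl (head-in a l))
          (allFrom-true l (suc a) f (λ i a<i i<l → every i (<⇒≤ a<i) (tail⇒window a l i<l)))

firstFrom-first : ∀ l a (f : ℕ → Bool) p → a ≤ p → p < a + l → f p ≡ true →
  (∀ j → a ≤ j → j < p → f j ≡ false) → firstFrom a l f ≡ p
firstFrom-first zero    a f p a≤p p<l fp before = ⊥-elim (empty-window a≤p p<l)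
firstFrom-first (suc l) a f p a≤p p<l fp before with m≤n⇒m<n∨m≡n a≤p
... | inj₂ refl rewrite fp = refl
... | inj₁ a<p  rewrite before a ≤-refl a<p =
  firstFrom-first l (suc a) f p a<p (window⇒tail a l p<l) fp (λ j a<j j<p → before j (<⇒≤ a<j) j<p)

window-bound : ∀ {a b i} → a ≤ i → i < a + (suc b ∸ a) → i ≤ b
window-bound {a} {b} {i} a≤i i<w with <-≤-connex (suc b) a
... | inj₁ b<a  = ⊥-elim (empty-window a≤i (subst (λ x → i < a + x) (m≤n⇒m∸n≡0 (<⇒≤ b<a)) i<w))
... | inj₂ a≤sb = ≤-pred (subst (i <_) (m+[n∸m]≡n a≤sb) i<w)

bound-window : ∀ {a b i} → a ≤ i → i ≤ b → i < a + (suc b ∸ a)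
bound-window {a} {b} {i} a≤i i≤b = subst (i <_) (sym (m+[n∸m]≡n (≤-trans a≤i (≤-trans i≤b (n≤1+n b))))) (s≤s i≤b)

allR-true⁻¹ : ∀ a b f → allR a b f ≡ true → ∀ i → a ≤ i → i ≤ b → f i ≡ true
allR-true⁻¹ a b f all i a≤i i≤b =
  allFrom-true⁻¹ (suc b ∸ a) a f (trans (sym (allR-allFrom a b f)) all) i a≤i (bound-window a≤i i≤b)

allR-true : ∀ a b f → (∀ i → a ≤ i → i ≤ b → f i ≡ true) → allR a b f ≡ true
allR-true a b f every =
  trans (allR-allFrom a b f) (allFrom-true (suc b ∸ a) a f (λ i a≤i i<w → every i a≤i (window-bound a≤i i<w)))

vecOf : ∀ {X : Set} m → (ℕ → X) → Vec X m
vecOf zero    g = []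
vecOf (suc m) g = g 0 ∷ vecOf m (g ∘ suc)

vAt-vecOf : ∀ {X : Set} (d : X) m g p → p < m → vAt d (vecOf m g) p ≡ g p
vAt-vecOf d (suc m) g zero    _         = refl
vAt-vecOf d (suc m) g (suc p) (s≤s p<m) = vAt-vecOf d m (g ∘ suc) p p<m

vAt-ext : ∀ {X : Set} (d : X) {m} (u v : Vec X m) → (∀ p → p < m → vAt d u p ≡ vAt d v p) → u ≡ v
vAt-ext d []      []      u≗v = refl
vAt-ext d (x ∷ u) (y ∷ v) u≗v = cong₂ _∷_ (u≗v 0 z<s) (vAt-ext d u v (λ p p<m → u≗v (suc p) (s≤s p<m)))

matOf : (n : ℕ) → (ℕ → ℕ → Bool) → Mat n
matOf n f = vecOf n (λ r → vecOf n (λ q → f (suc r) (suc q)))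

mat-matOf : ∀ n f i j → 1 ≤ i → i ≤ n → 1 ≤ j → j ≤ n → mat (matOf n f) i j ≡ f i j
mat-matOf n f (suc i) (suc j) _ i≤n _ j≤n =
  trans (cong (λ r → vAt false r j) (vAt-vecOf _ n _ i i≤n)) (vAt-vecOf false n _ j j≤n)

mat-ext : ∀ n (M M′ : Mat n) → (∀ i j → 1 ≤ i → i ≤ n → 1 ≤ j → j ≤ n → mat M i j ≡ mat M′ i j) → M ≡ M′
mat-ext n M M′ M≗M′ =
  vAt-ext _ M M′ (λ p p<n → vAt-ext false _ _ (λ q q<n → M≗M′ (suc p) (suc q) (s≤s z≤n) p<n (s≤s z≤n) q<n))

-- shift a skips the value a:  x ↦ x for x < a and x ↦ x + 1 for x ≥ a.  It is the
-- order-preserving bijection ℕ → ℕ ∖ {a}, used to insert a new column a into a permutation.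

shift : ℕ → ℕ → ℕ
shift a x = if x <ᵇ a then x else suc x

shift-lt : ∀ {a x} → x < a → shift a x ≡ x
shift-lt x<a = if-true (<ᵇ-true x<a)

shift-ge : ∀ {a x} → a ≤ x → shift a x ≡ suc x
shift-ge a≤x = if-false (<ᵇ-false a≤x)

shift-≢ : ∀ a x → shift a x ≢ a
shift-≢ a x e with <-≤-connex x a
... | inj₁ x<a = <-irrefl (trans (sym (shift-lt x<a)) e) x<a
... | inj₂ a≤x = <-irrefl (sym (trans (sym (shift-ge a≤x)) e)) (s≤s a≤x)

shift-inj : ∀ a x y → shift a x ≡ shift a y → x ≡ y
shift-inj a x y e with <-≤-connex x a | <-≤-connex y a
... | inj₁ x<a | inj₁ y<a = trans (sym (shift-lt x<a)) (trans e (shift-lt y<a))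
... | inj₂ a≤x | inj₂ a≤y = suc-injective (trans (sym (shift-ge a≤x)) (trans e (shift-ge a≤y)))
... | inj₁ x<a | inj₂ a≤y =
  ⊥-elim (<-asym (≤-trans x<a a≤y) (≤-reflexive (sym (trans (sym (shift-lt x<a)) (trans e (shift-ge a≤y))))))
... | inj₂ a≤x | inj₁ y<a =
  ⊥-elim (<-asym (≤-trans y<a a≤x) (≤-reflexive (trans (sym (shift-ge a≤x)) (trans e (shift-lt y<a)))))

shift-≡ᵇ : ∀ a x y → (shift a x ≡ᵇ shift a y) ≡ (x ≡ᵇ y)
shift-≡ᵇ a x y with x ≟ y
... | yes refl = trans (≡ᵇ-true {shift a x} refl) (sym (≡ᵇ-true {x} refl))
... | no x≢y   = trans (≡ᵇ-false (x≢y ∘ shift-inj a x y)) (sym (≡ᵇ-false x≢y))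

shift-<ᵇ : ∀ a x y → (shift a x <ᵇ shift a y) ≡ (x <ᵇ y)
shift-<ᵇ a x y with <-≤-connex x a | <-≤-connex y a
... | inj₁ x<a | inj₁ y<a rewrite shift-lt x<a | shift-lt y<a = refl
... | inj₂ a≤x | inj₂ a≤y rewrite shift-ge a≤x | shift-ge a≤y = refl
... | inj₁ x<a | inj₂ a≤y rewrite shift-lt x<a | shift-ge a≤y =
  trans (<ᵇ-true (≤-trans x<a (≤-trans a≤y (n≤1+n y)))) (sym (<ᵇ-true (≤-trans x<a a≤y)))
... | inj₂ a≤x | inj₁ y<a rewrite shift-ge a≤x | shift-lt y<a =
  trans (<ᵇ-false (≤-trans (<⇒≤ y<a) (≤-trans a≤x (n≤1+n x)))) (sym (<ᵇ-false (≤-trans (<⇒≤ y<a) a≤x)))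

shift-≤ᵇ-below : ∀ k a x → k ≤ a → (k ≤ᵇ shift a x) ≡ (k ≤ᵇ x)
shift-≤ᵇ-below k a x k≤a with <-≤-connex x a
... | inj₁ x<a rewrite shift-lt x<a = refl
... | inj₂ a≤x rewrite shift-ge a≤x =
  trans (≤ᵇ-true (≤-trans k≤a (≤-trans a≤x (n≤1+n x)))) (sym (≤ᵇ-true (≤-trans k≤a a≤x)))

shift-≤ᵇ-above : ∀ k a x → a ≤ k → (suc k ≤ᵇ shift a x) ≡ (k ≤ᵇ x)
shift-≤ᵇ-above k a x a≤k with <-≤-connex x a
... | inj₁ x<a rewrite shift-lt x<a =
  trans (≤ᵇ-false (≤-trans x<a (≤-trans a≤k (n≤1+n k)))) (sym (≤ᵇ-false (≤-trans x<a a≤k)))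
... | inj₂ a≤x rewrite shift-ge a≤x = <ᵇ-suc k x

shift-range : ∀ a N x → 1 ≤ x → x ≤ N → (1 ≤ shift a x) × (shift a x ≤ suc N)
shift-range a N x 1≤x x≤N with <-≤-connex x a
... | inj₁ x<a rewrite shift-lt x<a = 1≤x , ≤-trans x≤N (n≤1+n N)
... | inj₂ a≤x rewrite shift-ge a≤x = s≤s z≤n , s≤s x≤N

shift-onto : ∀ a N j → 1 ≤ a → a ≤ suc N → 1 ≤ j → j ≤ suc N → j ≢ a →
  Σ ℕ λ j′ → (1 ≤ j′) × (j′ ≤ N) × (shift a j′ ≡ j)
shift-onto a N j 1≤a a≤N 1≤j j≤N j≢a with <-≤-connex j a
... | inj₁ j<a = j , 1≤j , ≤-pred (≤-trans j<a a≤N) , shift-lt j<a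
shift-onto a N (suc j′) 1≤a a≤N 1≤j (s≤s j′≤N) j≢a | inj₂ a≤j with m≤n⇒m<n∨m≡n a≤j
... | inj₂ a≡j         = ⊥-elim (j≢a (sym a≡j))
... | inj₁ (s≤s a≤j′) = j′ , ≤-trans 1≤a a≤j′ , j′≤N , shift-ge a≤j′

IsCode : ℕ → (ℕ → ℕ) → Set
IsCode n c = ∀ i → i < n → c i ≤ i

IsCode-pred : ∀ N c → IsCode (suc N) c → IsCode N c
IsCode-pred N c code i i<N = code i (≤-trans i<N (n≤1+n N))

perm : ℕ → (ℕ → ℕ) → ℕ → ℕ
perm zero    c i = 0
perm (suc N) c i = if i ≡ᵇ suc N then suc (c N) else shift (suc (c N)) (perm N c i)

perm-top : ∀ N c → perm (suc N) c (suc N) ≡ suc (c N)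
perm-top N c = if-true (≡ᵇ-true {suc N} refl)

perm-low : ∀ N c i → i ≤ N → perm (suc N) c i ≡ shift (suc (c N)) (perm N c i)
perm-low N c i i≤N = if-false (≡ᵇ-false (<⇒≢ (s≤s i≤N)))

perm-cong : ∀ n c c′ → (∀ i → i < n → c i ≡ c′ i) → ∀ i → perm n c i ≡ perm n c′ i
perm-cong zero    c c′ c≗c′ i = refl
perm-cong (suc N) c c′ c≗c′ i
  rewrite c≗c′ N ≤-refl | perm-cong N c c′ (λ k k<N → c≗c′ k (≤-trans k<N (n≤1+n N))) i = refl

perm-range : ∀ n c → IsCode n c → ∀ i → 1 ≤ i → i ≤ n → (1 ≤ perm n c i) × (perm n c i ≤ n)
perm-range zero    c code i 1≤i i≤0 = ⊥-elim (≤⇒≯ i≤0 1≤i)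
perm-range (suc N) c code i 1≤i i≤n with m≤n⇒m<n∨m≡n i≤n
... | inj₂ refl rewrite perm-top N c = s≤s z≤n , s≤s (code N ≤-refl)
... | inj₁ (s≤s i≤N) rewrite perm-low N c i i≤N =
  let (1≤p , p≤N) = perm-range N c (IsCode-pred N c code) i 1≤i i≤N
  in shift-range (suc (c N)) N (perm N c i) 1≤p p≤N

perm-inj : ∀ n c → IsCode n c → ∀ i i′ → 1 ≤ i → i ≤ n → 1 ≤ i′ → i′ ≤ n → perm n c i ≡ perm n c i′ → i ≡ i′
perm-inj zero    c code i i′ 1≤i i≤0 _ _ _ = ⊥-elim (≤⇒≯ i≤0 1≤i)
perm-inj (suc N) c code i i′ 1≤i i≤n 1≤i′ i′≤n e with m≤n⇒m<n∨m≡n i≤n | m≤n⇒m<n∨m≡n i′≤n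
... | inj₂ refl      | inj₂ refl       = refl
... | inj₂ refl      | inj₁ (s≤s i′≤N) =
  ⊥-elim (shift-≢ _ (perm N c i′) (sym (trans (sym (perm-top N c)) (trans e (perm-low N c i′ i′≤N)))))
... | inj₁ (s≤s i≤N) | inj₂ refl       =
  ⊥-elim (shift-≢ _ (perm N c i) (trans (sym (perm-low N c i i≤N)) (trans e (perm-top N c))))
... | inj₁ (s≤s i≤N) | inj₁ (s≤s i′≤N) =
  perm-inj N c (IsCode-pred N c code) i i′ 1≤i i≤N 1≤i′ i′≤N
    (shift-inj (suc (c N)) _ _ (trans (sym (perm-low N c i i≤N)) (trans e (perm-low N c i′ i′≤N))))

perm-onto : ∀ n c → IsCode n c → ∀ j → 1 ≤ j → j ≤ n → Σ ℕ λ i → (1 ≤ i) × (i ≤ n) × (perm n c i ≡ j)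
perm-onto zero    c code j 1≤j j≤0 = ⊥-elim (≤⇒≯ j≤0 1≤j)
perm-onto (suc N) c code j 1≤j j≤n with j ≟ suc (c N)
... | yes refl = suc N , s≤s z≤n , ≤-refl , perm-top N c
... | no j≢a with shift-onto (suc (c N)) N j (s≤s z≤n) (s≤s (code N ≤-refl)) 1≤j j≤n j≢a
...   | j′ , 1≤j′ , j′≤N , shift-j′ with perm-onto N c (IsCode-pred N c code) j′ 1≤j′ j′≤N
...     | i , 1≤i , i≤N , perm-i =
  i , 1≤i , ≤-trans i≤N (n≤1+n N) , trans (perm-low N c i i≤N) (trans (cong (shift (suc (c N))) perm-i) shift-j′)

-- If row ℓ is sent to the last column, the code is maximal at ℓ - 1 (c (ℓ-1) = ℓ-1) and not
-- maximal afterwards (c i < i for ℓ ≤ i ≤ N): later rows were inserted left of column N+1.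
perm⁻¹-last : ∀ N c → IsCode (suc N) c → ∀ ℓ → 1 ≤ ℓ → ℓ ≤ suc N → perm (suc N) c ℓ ≡ suc N →
  (∀ i → ℓ ≤ i → i ≤ N → c i < i) × (2 ≤ ℓ → c (ℓ ∸ 1) ≡ ℓ ∸ 1)
perm⁻¹-last N c code ℓ 1≤ℓ ℓ≤n e with m≤n⇒m<n∨m≡n ℓ≤n
... | inj₂ refl = (λ i ℓ≤i i≤N → ⊥-elim (≤⇒≯ (≤-trans ℓ≤i i≤N) ≤-refl))
                , (λ _ → suc-injective (trans (sym (perm-top N c)) e))
perm⁻¹-last zero c code ℓ 1≤ℓ ℓ≤n e | inj₁ (s≤s ℓ≤0) = ⊥-elim (≤⇒≯ ℓ≤0 1≤ℓ)
perm⁻¹-last (suc N′) c code ℓ 1≤ℓ ℓ≤n e | inj₁ (s≤s ℓ≤N)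
  with perm-range (suc N′) c (IsCode-pred (suc N′) c code) ℓ 1≤ℓ ℓ≤N
     | <-≤-connex (perm (suc N′) c ℓ) (suc (c (suc N′)))
... | _ , p≤N | inj₁ p<a =
  ⊥-elim (≤⇒≯ p≤N (≤-reflexive (trans (sym e) (trans (perm-low (suc N′) c ℓ ℓ≤N) (shift-lt p<a)))))
... | _ , _ | inj₂ a≤p = below , proj₂ IH
  where
  p≡N : perm (suc N′) c ℓ ≡ suc N′
  p≡N = suc-injective (trans (sym (shift-ge a≤p)) (trans (sym (perm-low (suc N′) c ℓ ℓ≤N)) e))
  IH : (∀ i → ℓ ≤ i → i ≤ N′ → c i < i) × (2 ≤ ℓ → c (ℓ ∸ 1) ≡ ℓ ∸ 1)
  IH = perm⁻¹-last N′ c (IsCode-pred (suc N′) c code) ℓ 1≤ℓ ℓ≤N p≡N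
  below : ∀ i → ℓ ≤ i → i ≤ suc N′ → c i < i
  below i ℓ≤i i≤n with m≤n⇒m<n∨m≡n i≤n
  ... | inj₂ refl       = subst (suc (c (suc N′)) ≤_) p≡N a≤p
  ... | inj₁ (s≤s i≤N′) = proj₁ IH i ℓ≤i i≤N′

IsPerm : ℕ → (ℕ → ℕ → Bool) → Set
IsPerm n f = (∀ i → 1 ≤ i → i ≤ n → ExactlyOne 1 n (f i)) ×
             (∀ j → 1 ≤ j → j ≤ n → ExactlyOne 1 n (λ i → f i j))

isPermMat⇒IsPerm : ∀ n (M : Mat n) → T (isPermMat M) → IsPerm n (mat M)
isPermMat⇒IsPerm n M t = exactlyOne (∧-left lines) , exactlyOne (∧-right {rowsOK} lines)
  where
  lines : isPermMat M ≡ true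
  lines = T⇒≡true t
  rowsOK : Bool
  rowsOK = allR 1 n (λ i → sumR 1 n (λ j → bit (mat M i j)) ≡ᵇ 1)
  exactlyOne : ∀ {f : ℕ → ℕ → Bool} → allR 1 n (λ i → sumR 1 n (bit ∘ f i) ≡ᵇ 1) ≡ true →
    ∀ i → 1 ≤ i → i ≤ n → ExactlyOne 1 n (f i)
  exactlyOne {f} all i 1≤i i≤n =
    sumFrom-bits-1⁻¹ n 1 (f i) (trans (sym (sumR-sumFrom 1 n _)) (≡ᵇ-sound _ 1 (allR-true⁻¹ 1 n _ all i 1≤i i≤n)))

IsPerm⇒isPermMat : ∀ n (M : Mat n) → IsPerm n (mat M) → T (isPermMat M)
IsPerm⇒isPermMat n M (rows , cols) = ≡true⇒T (∧-intro (linesOK rows) (linesOK cols))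
  where
  linesOK : ∀ {f : ℕ → ℕ → Bool} → (∀ i → 1 ≤ i → i ≤ n → ExactlyOne 1 n (f i)) →
    allR 1 n (λ i → sumR 1 n (bit ∘ f i) ≡ᵇ 1) ≡ true
  linesOK one = allR-true 1 n _ λ i 1≤i i≤n →
    ≡ᵇ-true (trans (sumR-sumFrom 1 n _) (sumFrom-bits-1 n 1 _ (one i 1≤i i≤n)))

sigma-unique : ∀ n (M : Mat n) i p → 1 ≤ p → p ≤ n → mat M i p ≡ true →
  (∀ j → 1 ≤ j → j ≤ n → mat M i j ≡ true → j ≡ p) → sigma M i ≡ p
sigma-unique n M i p 1≤p p≤n Mip only-p =
  trans (firstR-firstFrom 1 n _) (firstFrom-first n 1 (mat M i) p 1≤p (s≤s p≤n) Mip before)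
  where
  before : ∀ j → 1 ≤ j → j < p → mat M i j ≡ false
  before j 1≤j j<p = ¬-not λ Mij → <-irrefl (only-p j 1≤j (≤-trans (<⇒≤ j<p) p≤n) Mij) j<p

sigma-perm : ∀ n (M : Mat n) → IsPerm n (mat M) → ∀ i p → 1 ≤ i → i ≤ n → 1 ≤ p → p ≤ n →
  mat M i p ≡ true → sigma M i ≡ p
sigma-perm n M (rows , _) i p 1≤i i≤n 1≤p p≤n Mip with rows i 1≤i i≤n
... | q , _ , _ , _ , only-q = sigma-unique n M i p 1≤p p≤n Mip
  (λ j 1≤j j≤n Mij → trans (only-q j 1≤j (s≤s j≤n) Mij) (sym (only-q p 1≤p (s≤s p≤n) Mip)))

codeMat : (n : ℕ) → (ℕ → ℕ) → Mat n
codeMat n c = matOf n (λ i j → j ≡ᵇ perm n c i)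

mat-codeMat : ∀ n c i j → 1 ≤ i → i ≤ n → 1 ≤ j → j ≤ n → mat (codeMat n c) i j ≡ (j ≡ᵇ perm n c i)
mat-codeMat n c = mat-matOf n (λ i j → j ≡ᵇ perm n c i)

codeMat-at-perm : ∀ n c → IsCode n c → ∀ i → 1 ≤ i → i ≤ n → mat (codeMat n c) i (perm n c i) ≡ true
codeMat-at-perm n c code i 1≤i i≤n =
  let (1≤p , p≤n) = perm-range n c code i 1≤i i≤n
  in trans (mat-codeMat n c i _ 1≤i i≤n 1≤p p≤n) (≡ᵇ-true {perm n c i} refl)

codeMat-IsPerm : ∀ n c → IsCode n c → IsPerm n (mat (codeMat n c))
codeMat-IsPerm n c code = rows , cols
  where
  rows : ∀ i → 1 ≤ i → i ≤ n → ExactlyOne 1 n (mat (codeMat n c) i)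
  rows i 1≤i i≤n =
    let (1≤p , p≤n) = perm-range n c code i 1≤i i≤n
    in perm n c i , 1≤p , s≤s p≤n , codeMat-at-perm n c code i 1≤i i≤n ,
       λ { j 1≤j (s≤s j≤n) Mij → ≡ᵇ-sound j _ (trans (sym (mat-codeMat n c i j 1≤i i≤n 1≤j j≤n)) Mij) }
  cols : ∀ j → 1 ≤ j → j ≤ n → ExactlyOne 1 n (λ i → mat (codeMat n c) i j)
  cols j 1≤j j≤n with perm-onto n c code j 1≤j j≤n
  ... | i , 1≤i , i≤n , refl =
    i , 1≤i , s≤s i≤n , codeMat-at-perm n c code i 1≤i i≤n ,
    λ { i′ 1≤i′ (s≤s i′≤n) Mi′j → perm-inj n c code i′ i 1≤i′ i′≤n 1≤i i≤n
          (sym (≡ᵇ-sound _ _ (trans (sym (mat-codeMat n c i′ _ 1≤i′ i′≤n 1≤j j≤n)) Mi′j))) }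

sigma-codeMat : ∀ n c → IsCode n c → ∀ i → 1 ≤ i → i ≤ n → sigma (codeMat n c) i ≡ perm n c i
sigma-codeMat n c code i 1≤i i≤n =
  let (1≤p , p≤n) = perm-range n c code i 1≤i i≤n
  in sigma-perm n (codeMat n c) (codeMat-IsPerm n c code) i _ 1≤i i≤n 1≤p p≤n (codeMat-at-perm n c code i 1≤i i≤n)

codeMat-cong : ∀ n c c′ → (∀ i → i < n → c i ≡ c′ i) → codeMat n c ≡ codeMat n c′
codeMat-cong n c c′ c≗c′ = mat-ext n _ _ λ i j 1≤i i≤n 1≤j j≤n → begin
  mat (codeMat n c) i j   ≡⟨ mat-codeMat n c i j 1≤i i≤n 1≤j j≤n ⟩
  (j ≡ᵇ perm n c i)       ≡⟨ cong (j ≡ᵇ_) (perm-cong n c c′ c≗c′ i) ⟩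
  (j ≡ᵇ perm n c′ i)      ≡⟨ sym (mat-codeMat n c′ i j 1≤i i≤n 1≤j j≤n) ⟩
  mat (codeMat n c′) i j  ∎
  where open ≡-Reasoning

invOf : ℕ → (ℕ → ℕ) → ℕ
invOf n σ = sumFrom 1 n (λ i → sumFrom (suc i) (n ∸ i) (λ j → bit (σ j <ᵇ σ i)))

inv-invOf : ∀ n (M : Mat n) → inv M ≡ invOf n (sigma M)
inv-invOf n M = trans (sumR-sumFrom 1 n _) (sumFrom-cong n 1 _ _ (λ i _ _ → sumR-sumFrom (suc i) n _))

invOf-cong : ∀ n σ σ′ → (∀ i → 1 ≤ i → i ≤ n → σ i ≡ σ′ i) → invOf n σ ≡ invOf n σ′
invOf-cong n σ σ′ σ≗σ′ = sumFrom-cong n 1 _ _ λ { i 1≤i (s≤s i≤n) →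
  sumFrom-cong (n ∸ i) (suc i) _ _ λ j i<j j<n →
    let j≤n = ≤-pred (subst (j <_) (cong suc (m+[n∸m]≡n i≤n)) j<n)
    in cong bit (cong₂ _<ᵇ_ (σ≗σ′ j (≤-trans 1≤i (<⇒≤ i<j)) j≤n) (σ≗σ′ i 1≤i i≤n)) }

sum-over-rows : ∀ N c (t : ℕ → ℕ) →
  sumFrom 1 (suc N) (t ∘ perm (suc N) c) ≡ sumFrom 1 N (t ∘ shift (suc (c N)) ∘ perm N c) + t (suc (c N))
sum-over-rows N c t =
  trans (sumFrom-snoc N 1 _)
        (cong₂ _+_ (sumFrom-cong N 1 _ _ (λ i _ i<n → cong t (perm-low N c i (≤-pred i<n)))) (cong t (perm-top N c)))

count-≥ : ∀ n c → IsCode n c → ∀ k → 1 ≤ k → k ≤ suc n → sumFrom 1 n (λ i → bit (k ≤ᵇ perm n c i)) ≡ suc n ∸ k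
count-≥ zero    c code (suc k) _ _ = sym (0∸n≡0 k)
count-≥ (suc N) c code k 1≤k k≤n with <-≤-connex (suc (c N)) k
... | inj₂ k≤a = begin
  sumFrom 1 (suc N) (λ i → bit (k ≤ᵇ perm (suc N) c i))
    ≡⟨ sum-over-rows N c (λ x → bit (k ≤ᵇ x)) ⟩
  sumFrom 1 N (λ i → bit (k ≤ᵇ shift a (perm N c i))) + bit (k ≤ᵇ a)
    ≡⟨ cong₂ _+_ (sumFrom-cong N 1 _ _ (λ i _ _ → cong bit (shift-≤ᵇ-below k a (perm N c i) k≤a)))
                 (cong bit (≤ᵇ-true k≤a)) ⟩
  sumFrom 1 N (λ i → bit (k ≤ᵇ perm N c i)) + 1
    ≡⟨ cong (_+ 1) (count-≥ N c (IsCode-pred N c code) k 1≤k k≤sN) ⟩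
  suc N ∸ k + 1
    ≡⟨ +-comm (suc N ∸ k) 1 ⟩
  suc (suc N ∸ k)
    ≡⟨ sym (+-∸-assoc 1 k≤sN) ⟩
  suc (suc N) ∸ k ∎
  where
  open ≡-Reasoning
  a = suc (c N)
  k≤sN : k ≤ suc N
  k≤sN = ≤-trans k≤a (s≤s (code N ≤-refl))
count-≥ (suc N) c code (suc k′) 1≤k (s≤s k′≤n) | inj₁ a<k = begin
  sumFrom 1 (suc N) (λ i → bit (suc k′ ≤ᵇ perm (suc N) c i))
    ≡⟨ sum-over-rows N c (λ x → bit (suc k′ ≤ᵇ x)) ⟩
  sumFrom 1 N (λ i → bit (suc k′ ≤ᵇ shift a (perm N c i))) + bit (suc k′ ≤ᵇ a)
    ≡⟨ cong₂ _+_ (sumFrom-cong N 1 _ _ (λ i _ _ → cong bit (shift-≤ᵇ-above k′ a (perm N c i) (≤-pred a<k))))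
                 (cong bit (≤ᵇ-false a<k)) ⟩
  sumFrom 1 N (λ i → bit (k′ ≤ᵇ perm N c i)) + 0
    ≡⟨ +-identityʳ _ ⟩
  sumFrom 1 N (λ i → bit (k′ ≤ᵇ perm N c i))
    ≡⟨ count-≥ N c (IsCode-pred N c code) k′ (≤-trans (s≤s z≤n) (≤-pred a<k)) k′≤n ⟩
  suc N ∸ k′ ∎
  where
  open ≡-Reasoning
  a = suc (c N)

-- Row i ≤ N of the inversion count of perm (N+1) c: its inversions among rows ≤ N, plus one
-- more exactly when the new last row lies in a column to its left.
row-inversions : ∀ N c i → 1 ≤ i → i ≤ N →
  sumFrom (suc i) (suc N ∸ i) (λ j → bit (perm (suc N) c j <ᵇ perm (suc N) c i)) ≡
  sumFrom (suc i) (N ∸ i) (λ j → bit (perm N c j <ᵇ perm N c i)) + bit (suc (c N) ≤ᵇ perm N c i)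
row-inversions N c i 1≤i i≤N = begin
  sumFrom (suc i) (suc N ∸ i) (λ j → bit (σ′ j <ᵇ σ′ i))
    ≡⟨ cong (λ l → sumFrom (suc i) l (λ j → bit (σ′ j <ᵇ σ′ i))) (+-∸-assoc 1 i≤N) ⟩
  sumFrom (suc i) (suc (N ∸ i)) (λ j → bit (σ′ j <ᵇ σ′ i))
    ≡⟨ sumFrom-snoc (N ∸ i) (suc i) _ ⟩
  sumFrom (suc i) (N ∸ i) (λ j → bit (σ′ j <ᵇ σ′ i)) + bit (σ′ (suc i + (N ∸ i)) <ᵇ σ′ i)
    ≡⟨ cong₂ _+_ (sumFrom-cong (N ∸ i) (suc i) _ _ earlier) last ⟩
  sumFrom (suc i) (N ∸ i) (λ j → bit (σ j <ᵇ σ i)) + bit (a ≤ᵇ σ i) ∎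
  where
  open ≡-Reasoning
  a = suc (c N)
  σ′ = perm (suc N) c
  σ = perm N c
  earlier : ∀ j → suc i ≤ j → j < suc i + (N ∸ i) → bit (σ′ j <ᵇ σ′ i) ≡ bit (σ j <ᵇ σ i)
  earlier j _ j<n =
    let j≤N = ≤-pred (subst (j <_) (cong suc (m+[n∸m]≡n i≤N)) j<n)
    in cong bit (trans (cong₂ _<ᵇ_ (perm-low N c j j≤N) (perm-low N c i i≤N)) (shift-<ᵇ a (σ j) (σ i)))
  last : bit (σ′ (suc i + (N ∸ i)) <ᵇ σ′ i) ≡ bit (a ≤ᵇ σ i)
  last = cong bit (begin
    σ′ (suc i + (N ∸ i)) <ᵇ σ′ i ≡⟨ cong₂ _<ᵇ_ (trans (cong (σ′ ∘ suc) (m+[n∸m]≡n i≤N)) (perm-top N c))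
                                              (perm-low N c i i≤N) ⟩
    a <ᵇ shift a (σ i)          ≡⟨ shift-≤ᵇ-above a a (σ i) ≤-refl ⟩
    a ≤ᵇ σ i                    ∎)

invOf-perm : ∀ n c → IsCode n c → invOf n (perm n c) ≡ sumFrom 0 n (λ i → i ∸ c i)
invOf-perm zero    c code = refl
invOf-perm (suc N) c code = begin
  invOf (suc N) (perm (suc N) c)
    ≡⟨ sumFrom-snoc N 1 _ ⟩
  sumFrom 1 N (λ i → sumFrom (suc i) (suc N ∸ i) (λ j → bit (σ′ j <ᵇ σ′ i)))
    + sumFrom (suc (suc N)) (suc N ∸ suc N) (λ j → bit (σ′ j <ᵇ σ′ (suc N)))
    ≡⟨ cong₂ _+_ (sumFrom-cong N 1 _ _ (λ i 1≤i i<n → row-inversions N c i 1≤i (≤-pred i<n)))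
                 (cong (λ l → sumFrom (suc (suc N)) l (λ j → bit (σ′ j <ᵇ σ′ (suc N)))) (n∸n≡0 N)) ⟩
  sumFrom 1 N (λ i → sumFrom (suc i) (N ∸ i) (λ j → bit (σ j <ᵇ σ i)) + bit (a ≤ᵇ σ i)) + 0
    ≡⟨ +-identityʳ _ ⟩
  sumFrom 1 N (λ i → sumFrom (suc i) (N ∸ i) (λ j → bit (σ j <ᵇ σ i)) + bit (a ≤ᵇ σ i))
    ≡⟨ sumFrom-+ N 1 _ _ ⟩
  invOf N σ + sumFrom 1 N (λ i → bit (a ≤ᵇ σ i))
    ≡⟨ cong₂ _+_ (invOf-perm N c code′) (count-≥ N c code′ a (s≤s z≤n) (s≤s (code N ≤-refl))) ⟩
  sumFrom 0 N (λ i → i ∸ c i) + (N ∸ c N)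
    ≡⟨ sym (sumFrom-snoc N 0 _) ⟩
  sumFrom 0 (suc N) (λ i → i ∸ c i) ∎
  where
  open ≡-Reasoning
  a = suc (c N)
  σ′ = perm (suc N) c
  σ = perm N c
  code′ : IsCode N c
  code′ = IsCode-pred N c code

inv-codeMat : ∀ n c → IsCode n c → inv (codeMat n c) ≡ sumFrom 0 n (λ i → i ∸ c i)
inv-codeMat n c code =
  trans (inv-invOf n (codeMat n c)) (trans (invOf-cong n _ _ (sigma-codeMat n c code)) (invOf-perm n c code))

deleteLast : ∀ {n} → Mat (suc n) → Mat n
deleteLast {n} M = matOf n (λ i j → mat M i (shift (sigma M (suc n)) j))

mat-deleteLast : ∀ n (M : Mat (suc n)) i j → 1 ≤ i → i ≤ n → 1 ≤ j → j ≤ n →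
  mat (deleteLast M) i j ≡ mat M i (shift (sigma M (suc n)) j)
mat-deleteLast n M = mat-matOf n (λ i j → mat M i (shift (sigma M (suc n)) j))

matCode : (n : ℕ) → Mat n → ℕ → ℕ
matCode zero    M i = 0
matCode (suc N) M i = if i ≡ᵇ N then sigma M (suc N) ∸ 1 else matCode N (deleteLast M) i

matCode-top : ∀ N (M : Mat (suc N)) → matCode (suc N) M N ≡ sigma M (suc N) ∸ 1
matCode-top N M = if-true (≡ᵇ-true {N} refl)

matCode-low : ∀ N (M : Mat (suc N)) i → i < N → matCode (suc N) M i ≡ matCode N (deleteLast M) i
matCode-low N M i i<N = if-false (≡ᵇ-false (<⇒≢ i<N))

record LastRow (N : ℕ) (M : Mat (suc N)) : Set where
  field
    1≤σ  : 1 ≤ sigma M (suc N)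
    σ≤n  : sigma M (suc N) ≤ suc N
    at-σ : mat M (suc N) (sigma M (suc N)) ≡ true
    only-σ : ∀ j → 1 ≤ j → j ≤ suc N → mat M (suc N) j ≡ true → j ≡ sigma M (suc N)
    column-σ : ∀ i → 1 ≤ i → i ≤ N → mat M i (sigma M (suc N)) ≡ false

lastRow : ∀ N (M : Mat (suc N)) → IsPerm (suc N) (mat M) → LastRow N M
lastRow N M (rows , cols) with rows (suc N) (s≤s z≤n) ≤-refl
... | p , 1≤p , p<n , Mnp , only-p = record
  { 1≤σ = subst (1 ≤_) (sym σ≡p) 1≤p
  ; σ≤n = subst (_≤ suc N) (sym σ≡p) (≤-pred p<n)
  ; at-σ = subst (λ x → mat M (suc N) x ≡ true) (sym σ≡p) Mnp
  ; only-σ = λ j 1≤j j≤n Mnj → trans (only-p j 1≤j (s≤s j≤n) Mnj) (sym σ≡p)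
  ; column-σ = column-p }
  where
  σ≡p : sigma M (suc N) ≡ p
  σ≡p = sigma-unique (suc N) M (suc N) p 1≤p (≤-pred p<n) Mnp (λ j 1≤j j≤n Mnj → only-p j 1≤j (s≤s j≤n) Mnj)
  column-p : ∀ i → 1 ≤ i → i ≤ N → mat M i (sigma M (suc N)) ≡ false
  column-p i 1≤i i≤N with cols p 1≤p (≤-pred p<n)
  ... | r , _ , _ , _ , only-r = ¬-not λ Mip →
    <⇒≢ (s≤s i≤N) (trans (only-r i 1≤i (s≤s (≤-trans i≤N (n≤1+n N))) (subst (λ x → mat M i x ≡ true) σ≡p Mip))
                         (sym (only-r (suc N) (s≤s z≤n) ≤-refl Mnp)))

deleteLast-IsPerm : ∀ N (M : Mat (suc N)) → IsPerm (suc N) (mat M) → IsPerm N (mat (deleteLast M))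
deleteLast-IsPerm N M P@(rows , cols) = rows′ , cols′
  where
  open LastRow (lastRow N M P)
  a = sigma M (suc N)
  rows′ : ∀ i → 1 ≤ i → i ≤ N → ExactlyOne 1 N (mat (deleteLast M) i)
  rows′ i 1≤i i≤N with rows i 1≤i (≤-trans i≤N (n≤1+n N))
  ... | p , 1≤p , p<n , Mip , only-p
    with shift-onto a N p 1≤σ σ≤n 1≤p (≤-pred p<n) (λ { refl → not-¬ refl (trans (sym (column-σ i 1≤i i≤N)) Mip) })
  ...   | p′ , 1≤p′ , p′≤N , shift-p′ =
    p′ , 1≤p′ , s≤s p′≤N , trans (mat-deleteLast N M i p′ 1≤i i≤N 1≤p′ p′≤N) (trans (cong (mat M i) shift-p′) Mip) ,
    λ { j 1≤j (s≤s j≤N) M′ij →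
          let (1≤s , s≤n) = shift-range a N j 1≤j j≤N
          in shift-inj a j p′ (trans (only-p (shift a j) 1≤s (s≤s s≤n)
                                        (trans (sym (mat-deleteLast N M i j 1≤i i≤N 1≤j j≤N)) M′ij))
                                     (sym shift-p′)) }
  cols′ : ∀ j → 1 ≤ j → j ≤ N → ExactlyOne 1 N (λ i → mat (deleteLast M) i j)
  cols′ j 1≤j j≤N with shift-range a N j 1≤j j≤N
  ... | 1≤s , s≤n with cols (shift a j) 1≤s s≤n
  ...   | r , 1≤r , r<n , Mrs , only-r with m≤n⇒m<n∨m≡n (≤-pred r<n)
  ...     | inj₂ refl      = ⊥-elim (shift-≢ a j (only-σ (shift a j) 1≤s s≤n Mrs))
  ...     | inj₁ (s≤s r≤N) =
    r , 1≤r , s≤s r≤N , trans (mat-deleteLast N M r j 1≤r r≤N 1≤j j≤N) Mrs ,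
    λ { i 1≤i (s≤s i≤N) M′ij →
          only-r i 1≤i (s≤s (≤-trans i≤N (n≤1+n N))) (trans (sym (mat-deleteLast N M i j 1≤i i≤N 1≤j j≤N)) M′ij) }

matCode-IsCode : ∀ n (M : Mat n) → IsPerm n (mat M) → IsCode n (matCode n M)
matCode-IsCode (suc N) M P i (s≤s i≤N) with m≤n⇒m<n∨m≡n i≤N
... | inj₂ refl = ≤-trans (≤-reflexive (matCode-top N M)) (∸-monoˡ-≤ 1 (LastRow.σ≤n (lastRow N M P)))
... | inj₁ i<N  =
  ≤-trans (≤-reflexive (matCode-low N M i i<N)) (matCode-IsCode N (deleteLast M) (deleteLast-IsPerm N M P) i i<N)

codeMat-matCode : ∀ n (M : Mat n) → IsPerm n (mat M) → codeMat n (matCode n M) ≡ M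
codeMat-matCode zero    [] P = refl
codeMat-matCode (suc N) M  P = mat-ext (suc N) _ M entry
  where
  open LastRow (lastRow N M P)
  open ≡-Reasoning
  a = sigma M (suc N)
  c = matCode (suc N) M
  c′ = matCode N (deleteLast M)

  new-column : suc (c N) ≡ a
  new-column = trans (cong suc (matCode-top N M)) (trans (+-comm 1 (a ∸ 1)) (m∸n+n≡m 1≤σ))

  old-columns : ∀ i → perm N c i ≡ perm N c′ i
  old-columns = perm-cong N c c′ (matCode-low N M)

  last-row : ∀ j → 1 ≤ j → j ≤ suc N → (j ≡ᵇ a) ≡ mat M (suc N) j
  last-row j 1≤j j≤n with j ≟ a
  ... | yes refl = trans (≡ᵇ-true {j} refl) (sym at-σ)
  ... | no j≢a   = trans (≡ᵇ-false j≢a) (sym (¬-not (j≢a ∘ only-σ j 1≤j j≤n)))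

  deleted : codeMat N c′ ≡ deleteLast M
  deleted = codeMat-matCode N (deleteLast M) (deleteLast-IsPerm N M P)

  other-row : ∀ i j → 1 ≤ i → i ≤ N → 1 ≤ j → j ≤ suc N → (j ≡ᵇ shift a (perm N c′ i)) ≡ mat M i j
  other-row i j 1≤i i≤N 1≤j j≤n with j ≟ a
  ... | yes refl = trans (≡ᵇ-false (shift-≢ a _ ∘ sym)) (sym (column-σ i 1≤i i≤N))
  ... | no j≢a with shift-onto a N j 1≤σ σ≤n 1≤j j≤n j≢a
  ...   | j′ , 1≤j′ , j′≤N , refl = begin
    (shift a j′ ≡ᵇ shift a (perm N c′ i)) ≡⟨ shift-≡ᵇ a j′ _ ⟩
    (j′ ≡ᵇ perm N c′ i)                  ≡⟨ sym (mat-codeMat N c′ i j′ 1≤i i≤N 1≤j′ j′≤N) ⟩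
    mat (codeMat N c′) i j′              ≡⟨ cong (λ X → mat X i j′) deleted ⟩
    mat (deleteLast M) i j′              ≡⟨ mat-deleteLast N M i j′ 1≤i i≤N 1≤j′ j′≤N ⟩
    mat M i (shift a j′)                 ∎

  entry : ∀ i j → 1 ≤ i → i ≤ suc N → 1 ≤ j → j ≤ suc N → mat (codeMat (suc N) c) i j ≡ mat M i j
  entry i j 1≤i i≤n 1≤j j≤n with m≤n⇒m<n∨m≡n i≤n
  ... | inj₂ refl = begin
    mat (codeMat (suc N) c) i j ≡⟨ mat-codeMat (suc N) c i j 1≤i i≤n 1≤j j≤n ⟩
    (j ≡ᵇ perm (suc N) c i)     ≡⟨ cong (j ≡ᵇ_) (trans (perm-top N c) new-column) ⟩
    (j ≡ᵇ a)                    ≡⟨ last-row j 1≤j j≤n ⟩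
    mat M i j                   ∎
  ... | inj₁ (s≤s i≤N) = begin
    mat (codeMat (suc N) c) i j   ≡⟨ mat-codeMat (suc N) c i j 1≤i i≤n 1≤j j≤n ⟩
    (j ≡ᵇ perm (suc N) c i)       ≡⟨ cong (j ≡ᵇ_) (trans (perm-low N c i i≤N) (cong₂ shift new-column (old-columns i))) ⟩
    (j ≡ᵇ shift a (perm N c′ i))  ≡⟨ other-row i j 1≤i i≤N 1≤j j≤n ⟩
    mat M i j                     ∎

deleteLast-codeMat : ∀ N c → IsCode (suc N) c → deleteLast (codeMat (suc N) c) ≡ codeMat N c
deleteLast-codeMat N c code = mat-ext N _ _ entry
  where
  open ≡-Reasoning
  X = codeMat (suc N) c
  a = suc (c N)
  σ-last : sigma X (suc N) ≡ a
  σ-last = trans (sigma-codeMat (suc N) c code (suc N) (s≤s z≤n) ≤-refl) (perm-top N c)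
  entry : ∀ i j → 1 ≤ i → i ≤ N → 1 ≤ j → j ≤ N → mat (deleteLast X) i j ≡ mat (codeMat N c) i j
  entry i j 1≤i i≤N 1≤j j≤N =
    let (1≤s , s≤n) = shift-range a N j 1≤j j≤N in begin
    mat (deleteLast X) i j                ≡⟨ mat-deleteLast N X i j 1≤i i≤N 1≤j j≤N ⟩
    mat X i (shift (sigma X (suc N)) j)   ≡⟨ cong (λ s → mat X i (shift s j)) σ-last ⟩
    mat X i (shift a j)                   ≡⟨ mat-codeMat (suc N) c i _ 1≤i (≤-trans i≤N (n≤1+n N)) 1≤s s≤n ⟩
    (shift a j ≡ᵇ perm (suc N) c i)       ≡⟨ cong (shift a j ≡ᵇ_) (perm-low N c i i≤N) ⟩
    (shift a j ≡ᵇ shift a (perm N c i))   ≡⟨ shift-≡ᵇ a j (perm N c i) ⟩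
    (j ≡ᵇ perm N c i)                     ≡⟨ sym (mat-codeMat N c i j 1≤i i≤N 1≤j j≤N) ⟩
    mat (codeMat N c) i j                 ∎

matCode-codeMat : ∀ n c → IsCode n c → ∀ i → i < n → matCode n (codeMat n c) i ≡ c i
matCode-codeMat (suc N) c code i (s≤s i≤N) with m≤n⇒m<n∨m≡n i≤N
... | inj₂ refl = trans (matCode-top N (codeMat (suc N) c))
                        (cong (_∸ 1) (trans (sigma-codeMat (suc N) c code (suc N) (s≤s z≤n) ≤-refl) (perm-top N c)))
... | inj₁ i<N  = trans (matCode-low N (codeMat (suc N) c) i i<N)
                 (trans (cong (λ X → matCode N X i) (deleteLast-codeMat N c code))
                        (matCode-codeMat N c (IsCode-pred N c code) i i<N))

if-∧-true : ∀ {x y b} → (if x ∧ y then b else false) ≡ true → (x ≡ true) × (y ≡ true) × (b ≡ true)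
if-∧-true {true}  {true}  e = refl , refl , e
if-∧-true {true}  {false} ()
if-∧-true {false} {_}     ()

vAt-true⁻¹ : ∀ {m} (v : Vec Bool m) p → vAt false v p ≡ true → p < m
vAt-true⁻¹ (x ∷ v) zero    _ = z<s
vAt-true⁻¹ (x ∷ v) (suc p) e = s≤s (vAt-true⁻¹ v p e)

rowsAt-true⁻¹ : ∀ k b i p → rowsAt k b i p ≡ true → (1 ≤ i) × (i ≤ k) × (p < i)
rowsAt-true⁻¹ (suc k) (rs , r) i p e with i ≟ suc k
... | yes refl = s≤s z≤n , ≤-refl , vAt-true⁻¹ r p (trans (sym (if-true (≡ᵇ-true {i} refl))) e)
... | no i≢k   =
  let (1≤i , i≤k , p<i) = rowsAt-true⁻¹ k rs i p (trans (sym (if-false (≡ᵇ-false i≢k))) e)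
  in 1≤i , ≤-trans i≤k (n≤1+n k) , p<i

row-start : ∀ N i p → i ≤ suc N → i + ((suc N ∸ i) + p) ≡ suc N + p
row-start N i p i≤n = trans (sym (+-assoc i _ p)) (cong (_+ p) (m+[n∸m]≡n i≤n))

tri-row : ∀ N b i p → i ≤ N → p < i → tri (suc N) b i ((suc N ∸ i) + p) ≡ rowsAt N b i p
tri-row N b i p i≤N p<i = trans (if-true (∧-intro (≤ᵇ-true inside-left) (<ᵇ-true inside-right))) position
  where
  i≤n : i ≤ suc N
  i≤n = ≤-trans i≤N (n≤1+n N)
  inside-left : suc N ≤ i + ((suc N ∸ i) + p)
  inside-left = ≤-trans (m≤m+n (suc N) p) (≤-reflexive (sym (row-start N i p i≤n)))
  inside-right : (suc N ∸ i) + p < suc N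
  inside-right = ≤-trans (+-monoʳ-< (suc N ∸ i) p<i) (≤-reflexive (trans (+-comm (suc N ∸ i) i) (m+[n∸m]≡n i≤n)))
  position : rowsAt N b i (i + ((suc N ∸ i) + p) ∸ suc N) ≡ rowsAt N b i p
  position = cong (rowsAt N b i) (trans (cong (_∸ suc N) (row-start N i p i≤n)) (m+n∸m≡n (suc N) p))

tri-true⁻¹ : ∀ N b i j → tri (suc N) b i j ≡ true →
  Σ ℕ λ p → (j ≡ (suc N ∸ i) + p) × (rowsAt N b i p ≡ true)
tri-true⁻¹ N b i j e with if-∧-true {suc N ≤ᵇ i + j} {j <ᵇ suc N} e
... | left , _ , at = i + j ∸ suc N , column , at
  where
  open ≡-Reasoning
  n≤i+j : suc N ≤ i + j
  n≤i+j = ≤ᵇ⇒≤ (suc N) (i + j) (≡true⇒T left)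
  i≤n : i ≤ suc N
  i≤n = ≤-trans (proj₁ (proj₂ (rowsAt-true⁻¹ N b i _ at))) (n≤1+n N)
  column : j ≡ (suc N ∸ i) + (i + j ∸ suc N)
  column = sym (begin
    (suc N ∸ i) + (i + j ∸ suc N) ≡⟨ sym (+-∸-assoc (suc N ∸ i) n≤i+j) ⟩
    (suc N ∸ i) + (i + j) ∸ suc N ≡⟨ cong (_∸ suc N) (sym (+-assoc (suc N ∸ i) i j)) ⟩
    (suc N ∸ i) + i + j ∸ suc N   ≡⟨ cong (λ x → x + j ∸ suc N) (m∸n+n≡m i≤n) ⟩
    suc N + j ∸ suc N             ≡⟨ m+n∸m≡n (suc N) j ⟩
    j                             ∎)

-- Weakly decreasing rows (positions outside a row read as 0, so no range conditions are needed).
RowsDecreasing : (k : ℕ) → Rows k → Set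
RowsDecreasing k b = ∀ i p → rowsAt k b i (suc p) ≡ true → rowsAt k b i p ≡ true

tri-decreasing : ∀ N b → RowsDecreasing N b → ∀ i j → suc N ≤ i + j →
  tri (suc N) b i (suc j) ≡ true → tri (suc N) b i j ≡ true
tri-decreasing N b dec i j n≤i+j e with tri-true⁻¹ N b i (suc j) e
... | zero , column , _ =
  ⊥-elim (≤⇒≯ start≤j (≤-reflexive (trans column (+-identityʳ (suc N ∸ i)))))
  where
  start≤j : suc N ∸ i ≤ j
  start≤j = ≤-trans (∸-monoˡ-≤ i n≤i+j) (≤-reflexive (m+n∸m≡n i j))
... | suc p , column , at with rowsAt-true⁻¹ N b i (suc p) at
...   | _ , i≤N , p<i = begin
  tri (suc N) b i j                 ≡⟨ cong (tri (suc N) b i) (suc-injective (trans column (+-suc (suc N ∸ i) p))) ⟩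
  tri (suc N) b i ((suc N ∸ i) + p) ≡⟨ tri-row N b i p i≤N (≤-trans (n≤1+n (suc p)) p<i) ⟩
  rowsAt N b i p                    ≡⟨ dec i p at ⟩
  true                              ∎
  where open ≡-Reasoning

∨-not-intro : ∀ x y → (y ≡ true → x ≡ true) → (x ∨ not y) ≡ true
∨-not-intro true  y     _   = refl
∨-not-intro false true  y⇒x = y⇒x refl
∨-not-intro false false _   = refl

∨-not-elim : ∀ x y → (x ∨ not y) ≡ true → y ≡ true → x ≡ true
∨-not-elim true  _    _ _ = refl
∨-not-elim false true e _ = e

decRows-decreasing : ∀ N b → RowsDecreasing N b → decRows (suc N) b ≡ true
decRows-decreasing N b dec = allR-true 1 N _ λ i _ i≤N → allR-true (suc N ∸ i) (N ∸ 1) _ λ j start≤j _ →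
  ∨-not-intro _ _ (tri-decreasing N b dec i j
    (≤-trans (≤-reflexive (sym (m+[n∸m]≡n (≤-trans i≤N (n≤1+n N))))) (+-monoʳ-≤ i start≤j)))

decreasing-decRows : ∀ N b → decRows (suc N) b ≡ true → RowsDecreasing N b
decreasing-decRows N b e i p at with rowsAt-true⁻¹ N b i (suc p) at
... | 1≤i , i≤N , p<i = begin
  rowsAt N b i p                            ≡⟨ sym (tri-row N b i p i≤N (<⇒≤ p<i)) ⟩
  tri (suc N) b i j                         ≡⟨ ∨-not-elim _ _ (allR-true⁻¹ start (N ∸ 1) _ row j (m≤m+n start p) j≤N-1) next ⟩
  true                                      ∎
  where
  open ≡-Reasoning
  start = suc N ∸ i
  j = start + p
  row : allR start (N ∸ 1) (λ j → tri (suc N) b i j ∨ not (tri (suc N) b i (suc j))) ≡ true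
  row = allR-true⁻¹ 1 N _ e i 1≤i i≤N
  end : start + i ≡ suc N
  end = trans (+-comm start i) (m+[n∸m]≡n (≤-trans i≤N (n≤1+n N)))
  j+2≤n : suc (suc j) ≤ suc N
  j+2≤n = ≤-trans (≤-reflexive (sym (trans (+-suc start (suc p)) (cong suc (+-suc start p)))))
                  (≤-trans (+-monoʳ-≤ start p<i) (≤-reflexive end))
  j≤N-1 : j ≤ N ∸ 1
  j≤N-1 = ∸-monoˡ-≤ 1 (≤-pred j+2≤n)
  next : tri (suc N) b i (suc j) ≡ true
  next = trans (cong (tri (suc N) b i) (sym (+-suc start p))) (trans (tri-row N b i (suc p) i≤N p<i) at)

-- The TSSCPP condition holds for every triangle with weakly decreasing rows: on the diagonal
-- n-j each entry of row i > j is at most its left neighbour on diagonal n-j-1, so the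
-- partial sum of diagonal n-j exceeds that of diagonal n-j-1 by at most its first entry.

bit-mono : ∀ x y → (x ≡ true → y ≡ true) → bit x ≤ bit y
bit-mono true  y x⇒y rewrite x⇒y refl = ≤-refl
bit-mono false y _   = z≤n

bit≤1 : ∀ x → bit x ≤ 1
bit≤1 true  = ≤-refl
bit≤1 false = z≤n

tri-column-n-empty : ∀ N b i → tri (suc N) b i (suc N) ≡ true → ⊥
tri-column-n-empty N b i e =
  <-irrefl refl (<ᵇ-sound (suc N) (suc N) (proj₁ (proj₂ (if-∧-true {suc N ≤ᵇ i + suc N} e))))

diagonal-step : ∀ N b → RowsDecreasing N b → ∀ j i → j ≤ N → suc j ≤ i →
  bit (tri (suc N) b i (suc N ∸ j)) ≤ bit (tri (suc N) b i (suc N ∸ j ∸ 1))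
diagonal-step N b dec zero     i _     _   = bit-mono _ _ (⊥-elim ∘ tri-column-n-empty N b i)
diagonal-step N b dec (suc j′) i j≤N j<i = bit-mono _ _ λ e →
  subst (λ x → tri (suc N) b i (x ∸ 1) ≡ true) (sym column)
        (tri-decreasing N b dec i col inside (subst (λ x → tri (suc N) b i x ≡ true) column e))
  where
  col = N ∸ suc j′
  column : N ∸ j′ ≡ suc col
  column = +-∸-assoc 1 j≤N
  inside : suc N ≤ i + col
  inside = ≤-trans (≤-reflexive (cong suc (sym (m+[n∸m]≡n j≤N)))) (+-monoˡ-≤ col j<i)

diagonal-condition : ∀ N b → RowsDecreasing N b → ∀ j i′ → j ≤ N → j ≤ i′ →
  sumR j i′ (λ i → bit (tri (suc N) b i (suc N ∸ j)))
    ≤ 1 + sumR (suc j) i′ (λ i → bit (tri (suc N) b i (suc N ∸ j ∸ 1)))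
diagonal-condition N b dec j i′ j≤N j≤i′ = begin
  sumR j i′ diag                          ≡⟨ sumR-sumFrom j i′ diag ⟩
  sumFrom j (suc i′ ∸ j) diag             ≡⟨ cong (λ l → sumFrom j l diag) (+-∸-assoc 1 j≤i′) ⟩
  diag j + sumFrom (suc j) (i′ ∸ j) diag  ≤⟨ +-mono-≤ (bit≤1 _) (sumFrom-mono (i′ ∸ j) (suc j) diag left
                                                (λ i j<i _ → diagonal-step N b dec j i j≤N j<i)) ⟩
  1 + sumFrom (suc j) (i′ ∸ j) left       ≡⟨ cong (1 +_) (sym (sumR-sumFrom (suc j) i′ left)) ⟩
  1 + sumR (suc j) i′ left                ∎
  where
  open ≤-Reasoning
  diag = λ i → bit (tri (suc N) b i (suc N ∸ j))
  left = λ i → bit (tri (suc N) b i (suc N ∸ j ∸ 1))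

isTSSCPP-decreasing : ∀ N b → RowsDecreasing N b → isTSSCPP (suc N) b ≡ true
isTSSCPP-decreasing N b dec = allR-true 0 N _ λ j _ j≤N → allR-true j N _ λ i′ j≤i′ _ →
  ≤ᵇ-true (diagonal-condition N b dec j i′ j≤N j≤i′)

codeTri : (k : ℕ) → (ℕ → ℕ) → Rows k
codeTri zero    c = tt
codeTri (suc k) c = codeTri k c , vecOf (suc k) (λ p → p <ᵇ c (suc k))

codeTri-cong : ∀ k c c′ → (∀ i → 1 ≤ i → i ≤ k → c i ≡ c′ i) → codeTri k c ≡ codeTri k c′
codeTri-cong zero    c c′ c≗c′ = refl
codeTri-cong (suc k) c c′ c≗c′ =
  cong₂ _,_ (codeTri-cong k c c′ (λ i 1≤i i≤k → c≗c′ i 1≤i (≤-trans i≤k (n≤1+n k))))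
            (cong (λ x → vecOf (suc k) (λ p → p <ᵇ x)) (c≗c′ (suc k) (s≤s z≤n) ≤-refl))

rowsAt-codeTri : ∀ k c i p → 1 ≤ i → i ≤ k → p < i → rowsAt k (codeTri k c) i p ≡ (p <ᵇ c i)
rowsAt-codeTri zero    c i p 1≤i i≤0 _ = ⊥-elim (≤⇒≯ i≤0 1≤i)
rowsAt-codeTri (suc k) c i p 1≤i i≤n p<i with i ≟ suc k
... | yes refl = trans (if-true (≡ᵇ-true {i} refl)) (vAt-vecOf false (suc k) (λ q → q <ᵇ c (suc k)) p p<i)
... | no i≢n   = trans (if-false (≡ᵇ-false i≢n)) (rowsAt-codeTri k c i p 1≤i (≤-pred (≤∧≢⇒< i≤n i≢n)) p<i)

codeTri-decreasing : ∀ k c → RowsDecreasing k (codeTri k c)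
codeTri-decreasing k c i p at with rowsAt-true⁻¹ k (codeTri k c) i (suc p) at
... | 1≤i , i≤k , p<i =
  trans (rowsAt-codeTri k c i p 1≤i i≤k (<⇒≤ p<i))
        (<ᵇ-true (<⇒≤ (<ᵇ-sound (suc p) (c i) (trans (sym (rowsAt-codeTri k c i (suc p) 1≤i i≤k p<i)) at))))

count-not-below : ∀ i c → sumFrom 0 i (λ q → bit (not (q <ᵇ c))) ≡ i ∸ c
count-not-below zero    c = sym (0∸n≡0 c)
count-not-below (suc i) c with <-≤-connex i c
... | inj₁ i<c = begin
  sumFrom 0 (suc i) atLeast          ≡⟨ sumFrom-snoc i 0 atLeast ⟩
  sumFrom 0 i atLeast + atLeast i    ≡⟨ cong₂ _+_ (count-not-below i c) (cong (bit ∘ not) (<ᵇ-true i<c)) ⟩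
  i ∸ c + 0                          ≡⟨ +-identityʳ (i ∸ c) ⟩
  i ∸ c                              ≡⟨ m≤n⇒m∸n≡0 (<⇒≤ i<c) ⟩
  0                                  ≡⟨ sym (m≤n⇒m∸n≡0 i<c) ⟩
  suc i ∸ c                          ∎
  where
  open ≡-Reasoning
  atLeast = λ q → bit (not (q <ᵇ c))
... | inj₂ c≤i = begin
  sumFrom 0 (suc i) atLeast          ≡⟨ sumFrom-snoc i 0 atLeast ⟩
  sumFrom 0 i atLeast + atLeast i    ≡⟨ cong₂ _+_ (count-not-below i c) (cong (bit ∘ not) (<ᵇ-false c≤i)) ⟩
  i ∸ c + 1                          ≡⟨ +-comm (i ∸ c) 1 ⟩
  suc (i ∸ c)                        ≡⟨ sym (+-∸-assoc 1 c≤i) ⟩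
  suc i ∸ c                          ∎
  where
  open ≡-Reasoning
  atLeast = λ q → bit (not (q <ᵇ c))

row-zeros : ∀ N c i → 1 ≤ i → i ≤ N →
  sumR (suc N ∸ i) N (λ j → bit (not (tri (suc N) (codeTri N c) i j))) ≡ i ∸ c i
row-zeros N c i 1≤i i≤N = begin
  sumR start N entry
    ≡⟨ sumR-sumFrom start N entry ⟩
  sumFrom start (suc N ∸ start) entry
    ≡⟨ cong (λ l → sumFrom start l entry) (m∸[m∸n]≡n (≤-trans i≤N (n≤1+n N))) ⟩
  sumFrom start i entry
    ≡⟨ cong (λ a → sumFrom a i entry) (sym (+-identityʳ start)) ⟩
  sumFrom (start + 0) i entry
    ≡⟨ sumFrom-shift i start 0 entry ⟩
  sumFrom 0 i (λ q → entry (start + q))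
    ≡⟨ sumFrom-cong i 0 _ _ (λ q _ q<i → cong (bit ∘ not)
         (trans (tri-row N _ i q i≤N q<i) (rowsAt-codeTri N c i q 1≤i i≤N q<i))) ⟩
  sumFrom 0 i (λ q → bit (not (q <ᵇ c i)))
    ≡⟨ count-not-below i (c i) ⟩
  i ∸ c i ∎
  where
  open ≡-Reasoning
  start = suc N ∸ i
  entry = λ j → bit (not (tri (suc N) (codeTri N c) i j))

zeros-codeTri : ∀ N c → zeros (suc N) (codeTri N c) ≡ sumFrom 0 (suc N) (λ i → i ∸ c i)
zeros-codeTri N c =
  trans (sumR-sumFrom 1 N _)
        (trans (sumFrom-cong N 1 _ _ (λ i 1≤i i<n → row-zeros N c i 1≤i (≤-pred i<n)))
               (cong (_+ sumFrom 1 N (λ i → i ∸ c i)) (sym (0∸n≡0 (c 0)))))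

zerosLastRow-codeTri : ∀ N c → 1 ≤ N → zerosLastRow (suc N) (codeTri N c) ≡ N ∸ c N
zerosLastRow-codeTri N c 1≤N =
  trans (cong (λ a → sumR a N (λ j → bit (not (tri (suc N) (codeTri N c) N j)))) (sym (m+n∸n≡m 1 N)))
        (row-zeros N c N 1≤N ≤-refl)

lastColumn-codeTri : ∀ N c i → 1 ≤ i → i ≤ N → tri (suc N) (codeTri N c) i N ≡ (i ∸ 1 <ᵇ c i)
lastColumn-codeTri N c (suc i′) _ i≤N =
  trans (cong (tri (suc N) (codeTri N c) (suc i′)) (sym (m∸n+n≡m (<⇒≤ i≤N))))
        (trans (tri-row N _ (suc i′) i′ i≤N ≤-refl) (rowsAt-codeTri N c (suc i′) i′ (s≤s z≤n) i≤N ≤-refl))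

ones : ∀ {m} → Vec Bool m → ℕ
ones []       = 0
ones (x ∷ xs) = bit x + ones xs

rowSums : (k : ℕ) → Rows k → ℕ → ℕ
rowSums zero    _        i = 0
rowSums (suc k) (rs , r) i = if i ≡ᵇ suc k then ones r else rowSums k rs i

rowSums-top : ∀ k rs r → rowSums (suc k) (rs , r) (suc k) ≡ ones r
rowSums-top k rs r = if-true (≡ᵇ-true {suc k} refl)

rowSums-low : ∀ k rs r i → i ≤ k → rowSums (suc k) (rs , r) i ≡ rowSums k rs i
rowSums-low k rs r i i≤k = if-false (≡ᵇ-false (<⇒≢ (s≤s i≤k)))

rowSums-zero : ∀ k b → rowSums k b 0 ≡ 0
rowSums-zero zero    _        = refl
rowSums-zero (suc k) (rs , _) = rowSums-zero k rs

rowsAt-top : ∀ k rs r p → rowsAt (suc k) (rs , r) (suc k) p ≡ vAt false r p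
rowsAt-top k rs r p = if-true (≡ᵇ-true {suc k} refl)

rowsAt-low : ∀ k rs r i p → i ≤ k → rowsAt (suc k) (rs , r) i p ≡ rowsAt k rs i p
rowsAt-low k rs r i p i≤k = if-false (≡ᵇ-false (<⇒≢ (s≤s i≤k)))

ones≤length : ∀ {m} (v : Vec Bool m) → ones v ≤ m
ones≤length []          = z≤n
ones≤length (true ∷ v)  = s≤s (ones≤length v)
ones≤length (false ∷ v) = ≤-trans (ones≤length v) (n≤1+n _)

rowSums-IsCode : ∀ k b → IsCode (suc k) (rowSums k b)
rowSums-IsCode zero    _        i _ = z≤n
rowSums-IsCode (suc k) (rs , r) i i<n with i ≟ suc k
... | yes refl = ≤-trans (≤-reflexive (rowSums-top k rs r)) (ones≤length r)
... | no i≢n   = ≤-trans (≤-reflexive (rowSums-low k rs r i i≤k)) (rowSums-IsCode k rs i (s≤s i≤k))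
  where
  i≤k : i ≤ k
  i≤k = ≤-pred (≤∧≢⇒< (≤-pred i<n) i≢n)

ones-vecOf : ∀ i c → c ≤ i → ones (vecOf i (λ p → p <ᵇ c)) ≡ c
ones-vecOf zero    zero    _         = refl
ones-vecOf (suc i) zero    _         = ones-vecOf i zero z≤n
ones-vecOf (suc i) (suc c) (s≤s c≤i) = cong suc (ones-vecOf i c c≤i)

rowSums-codeTri : ∀ k c → IsCode (suc k) c → ∀ i → i < suc k → rowSums k (codeTri k c) i ≡ c i
rowSums-codeTri k       c code zero    _         = trans (rowSums-zero k _) (sym (n≤0⇒n≡0 (code 0 z<s)))
rowSums-codeTri (suc k) c code (suc i) (s≤s i≤n) with suc i ≟ suc k
... | yes refl = trans (rowSums-top k (codeTri k c) newRow) (ones-vecOf (suc k) (c (suc k)) (code (suc k) ≤-refl))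
  where newRow = vecOf (suc k) (λ p → p <ᵇ c (suc k))
... | no i≢n   = trans (rowSums-low k (codeTri k c) newRow (suc i) i<n)
                       (rowSums-codeTri k c (IsCode-pred (suc k) c code) (suc i) (s≤s i<n))
  where
  newRow = vecOf (suc k) (λ p → p <ᵇ c (suc k))
  i<n : suc i ≤ k
  i<n = ≤-pred (≤∧≢⇒< i≤n i≢n)

VecDecreasing : ∀ {m} → Vec Bool m → Set
VecDecreasing v = ∀ p → vAt false v (suc p) ≡ true → vAt false v p ≡ true

vecOf-ones : ∀ {m} (v : Vec Bool m) → VecDecreasing v → vecOf m (λ p → p <ᵇ ones v) ≡ v
vecOf-ones []           dec = refl
vecOf-ones (true ∷ xs)  dec = cong (true ∷_) (vecOf-ones xs (dec ∘ suc))
vecOf-ones {suc m} (false ∷ xs) dec =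
  trans (cong (λ k → vecOf (suc m) (λ p → p <ᵇ k)) no-ones)
        (cong (false ∷_) (vAt-ext false (vecOf m (λ _ → false)) xs all-zero))
  where
  false-tail : ∀ p → vAt false xs p ≡ false
  false-tail zero    = ¬-not (not-¬ refl ∘ dec 0)
  false-tail (suc p) = ¬-not (not-¬ refl ∘ trans (sym (false-tail p)) ∘ dec (suc p))
  all-zero : ∀ p → p < m → vAt false (vecOf m (λ _ → false)) p ≡ vAt false xs p
  all-zero p p<m = trans (vAt-vecOf false m _ p p<m) (sym (false-tail p))
  no-ones : ones xs ≡ 0
  no-ones = trans (cong ones (sym (vAt-ext false (vecOf m (λ _ → false)) xs all-zero))) (ones-vecOf m 0 z≤n)

codeTri-rowSums : ∀ k b → RowsDecreasing k b → codeTri k (rowSums k b) ≡ b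
codeTri-rowSums zero    _        dec = refl
codeTri-rowSums (suc k) (rs , r) dec = cong₂ _,_ earlier-rows last-row
  where
  earlier-rows : codeTri k (rowSums (suc k) (rs , r)) ≡ rs
  earlier-rows = trans (codeTri-cong k _ _ (λ i _ i≤k → rowSums-low k rs r i i≤k)) (codeTri-rowSums k rs dec′)
    where
    dec′ : RowsDecreasing k rs
    dec′ i p at =
      let i≤k = proj₁ (proj₂ (rowsAt-true⁻¹ k rs i (suc p) at))
      in trans (sym (rowsAt-low k rs r i p i≤k)) (dec i p (trans (rowsAt-low k rs r i (suc p) i≤k) at))
  last-row : vecOf (suc k) (λ p → p <ᵇ rowSums (suc k) (rs , r) (suc k)) ≡ r
  last-row = trans (cong (λ x → vecOf (suc k) (λ p → p <ᵇ x)) (rowSums-top k rs r))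
                   (vecOf-ones r λ p e →
                      trans (sym (rowsAt-top k rs r p)) (dec (suc k) p (trans (rowsAt-top k rs r (suc p)) e)))

Φ : ∀ N → PermMat (suc N) → BoolTri (suc N)
Φ N (M , _) = codeTri N c , ≡true⇒T (∧-intro (isTSSCPP-decreasing N _ dec) (decRows-decreasing N _ dec))
  where
  c = matCode (suc N) M
  dec : RowsDecreasing N (codeTri N c)
  dec = codeTri-decreasing N c

Ψ : ∀ N → BoolTri (suc N) → PermMat (suc N)
Ψ N (b , _) = M , IsPerm⇒isPermMat (suc N) M (codeMat-IsPerm (suc N) r (rowSums-IsCode N b))
  where
  r = rowSums N b
  M = codeMat (suc N) r

Ψ∘Φ : ∀ N P → Ψ N (Φ N P) ≡ P
Ψ∘Φ N (M , t) = Σ-≡,≡→≡ (matrices , T-irrelevant _ _)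
  where
  P : IsPerm (suc N) (mat M)
  P = isPermMat⇒IsPerm (suc N) M t
  c = matCode (suc N) M
  matrices : codeMat (suc N) (rowSums N (codeTri N c)) ≡ M
  matrices = trans (codeMat-cong (suc N) _ c (rowSums-codeTri N c (matCode-IsCode (suc N) M P)))
                   (codeMat-matCode (suc N) M P)

Φ∘Ψ : ∀ N B → Φ N (Ψ N B) ≡ B
Φ∘Ψ N (b , t) = Σ-≡,≡→≡ (triangles , T-irrelevant _ _)
  where
  r = rowSums N b
  triangles : codeTri N (matCode (suc N) (codeMat (suc N) r)) ≡ b
  triangles = trans (codeTri-cong N _ r (λ i _ i≤N → matCode-codeMat (suc N) r (rowSums-IsCode N b) i (s≤s i≤N)))
                    (codeTri-rowSums N b (decreasing-decRows N b (∧-right {isTSSCPP (suc N) b} (T⇒≡true t))))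

Φ-bijective : ∀ N → Bijective _≡_ _≡_ (Φ N)
Φ-bijective N = Bijection.bijective (↔⇒⤖ (mk↔ₛ′ (Φ N) (Ψ N) (Φ∘Ψ N) (Ψ∘Φ N)))

perm-matCode : ∀ n (M : Mat n) → IsPerm n (mat M) → ∀ i j → 1 ≤ i → i ≤ n → 1 ≤ j → j ≤ n →
  mat M i j ≡ true → j ≡ perm n (matCode n M) i
perm-matCode n M P i j 1≤i i≤n 1≤j j≤n Mij = ≡ᵇ-sound j _ (begin
  (j ≡ᵇ perm n (matCode n M) i)  ≡⟨ sym (mat-codeMat n _ i j 1≤i i≤n 1≤j j≤n) ⟩
  mat (codeMat n (matCode n M)) i j ≡⟨ cong (λ X → mat X i j) (codeMat-matCode n M P) ⟩
  mat M i j                      ≡⟨ Mij ⟩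
  true                           ∎)
  where open ≡-Reasoning

zeros-Φ : ∀ N (M : Mat (suc N)) → IsPerm (suc N) (mat M) → zeros (suc N) (codeTri N (matCode (suc N) M)) ≡ inv M
zeros-Φ N M P = begin
  zeros (suc N) (codeTri N c)          ≡⟨ zeros-codeTri N c ⟩
  sumFrom 0 (suc N) (λ i → i ∸ c i)    ≡⟨ sym (inv-codeMat (suc N) c (matCode-IsCode (suc N) M P)) ⟩
  inv (codeMat (suc N) c)              ≡⟨ cong inv (codeMat-matCode (suc N) M P) ⟩
  inv M                                ∎
  where
  open ≡-Reasoning
  c = matCode (suc N) M

zerosLastRow-Φ : ∀ N (M : Mat (suc N)) → IsPerm (suc N) (mat M) → 1 ≤ N → ∀ k → 1 ≤ k → k ≤ suc N →
  mat M (suc N) k ≡ true → zerosLastRow (suc N) (codeTri N (matCode (suc N) M)) ≡ suc N ∸ k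
zerosLastRow-Φ N M P 1≤N k 1≤k k≤n Mnk =
  trans (zerosLastRow-codeTri N c 1≤N)
        (cong (suc N ∸_) (sym (trans (perm-matCode (suc N) M P (suc N) k (s≤s z≤n) ≤-refl 1≤k k≤n Mnk) (perm-top N c))))
  where c = matCode (suc N) M

lastColumn-Φ : ∀ N (M : Mat (suc N)) → IsPerm (suc N) (mat M) → ∀ ℓ → 1 ≤ ℓ → ℓ ≤ suc N →
  mat M ℓ (suc N) ≡ true →
  (∀ i → ℓ ≤ i → i ≤ N → tri (suc N) (codeTri N (matCode (suc N) M)) i N ≡ false) ×
  (2 ≤ ℓ → tri (suc N) (codeTri N (matCode (suc N) M)) (ℓ ∸ 1) N ≡ true)
lastColumn-Φ N M P ℓ 1≤ℓ ℓ≤n Mℓn = below , at-row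
  where
  c = matCode (suc N) M
  last : (∀ i → ℓ ≤ i → i ≤ N → c i < i) × (2 ≤ ℓ → c (ℓ ∸ 1) ≡ ℓ ∸ 1)
  last = perm⁻¹-last N c (matCode-IsCode (suc N) M P) ℓ 1≤ℓ ℓ≤n
           (sym (perm-matCode (suc N) M P ℓ (suc N) 1≤ℓ ℓ≤n (s≤s z≤n) ≤-refl Mℓn))
  below : ∀ i → ℓ ≤ i → i ≤ N → tri (suc N) (codeTri N c) i N ≡ false
  below i ℓ≤i i≤N =
    trans (lastColumn-codeTri N c i (≤-trans 1≤ℓ ℓ≤i) i≤N) (<ᵇ-false (∸-monoˡ-≤ 1 (proj₁ last i ℓ≤i i≤N)))
  at-row : 2 ≤ ℓ → tri (suc N) (codeTri N c) (ℓ ∸ 1) N ≡ true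
  at-row (s≤s (s≤s {n = ℓ′} _)) =
    trans (lastColumn-codeTri N c (suc ℓ′) (s≤s z≤n) (≤-pred ℓ≤n))
          (trans (cong (ℓ′ <ᵇ_) (proj₂ last (s≤s (s≤s z≤n)))) (<ᵇ-true (n<1+n ℓ′)))

theorem3p5 : (n : ℕ) → 2 ≤ n →
    Σ (PermMat n → BoolTri n) λ Φ →
      Bijective _≡_ _≡_ Φ ×
      ((P : PermMat n) →
        (zeros n (proj₁ (Φ P)) ≡ inv (proj₁ P)) ×
        ((k : ℕ) → 1 ≤ k → k ≤ n → mat (proj₁ P) n k ≡ true →
          zerosLastRow n (proj₁ (Φ P)) ≡ n ∸ k) ×
        ((ℓ : ℕ) → 1 ≤ ℓ → ℓ ≤ n → mat (proj₁ P) ℓ n ≡ true →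
          ((i : ℕ) → ℓ ≤ i → i ≤ n ∸ 1 → tri n (proj₁ (Φ P)) i (n ∸ 1) ≡ false) ×
          (2 ≤ ℓ → tri n (proj₁ (Φ P)) (ℓ ∸ 1) (n ∸ 1) ≡ true)))
theorem3p5 (suc (suc m)) (s≤s (s≤s z≤n)) =
  Φ N , Φ-bijective N , λ { (M , t) → properties M (isPermMat⇒IsPerm (suc N) M t) }
  where
  N = suc m
  properties : (M : Mat (suc N)) → (P : IsPerm (suc N) (mat M)) →
    (zeros (suc N) (codeTri N (matCode (suc N) M)) ≡ inv M) ×
    ((k : ℕ) → 1 ≤ k → k ≤ suc N → mat M (suc N) k ≡ true →
      zerosLastRow (suc N) (codeTri N (matCode (suc N) M)) ≡ suc N ∸ k) ×
    ((ℓ : ℕ) → 1 ≤ ℓ → ℓ ≤ suc N → mat M ℓ (suc N) ≡ true →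
      ((i : ℕ) → ℓ ≤ i → i ≤ N → tri (suc N) (codeTri N (matCode (suc N) M)) i N ≡ false) ×
      (2 ≤ ℓ → tri (suc N) (codeTri N (matCode (suc N) M)) (ℓ ∸ 1) N ≡ true))
  properties M P = zeros-Φ N M P , zerosLastRow-Φ N M P (s≤s z≤n) , lastColumn-Φ N M P
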